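{- Let $m$ be a positive integer, $a\in\mathbb{Z}$, and let $q>1$ be an integer relatively prime to both $m$ and $\sum_{j=0}^{m-1}(-a)^j$. Let $l\in\{0,1,2,\ldots\}$ and $r\in\mathbb{Z}$. If $n,T$ are positive integers with $\nu_m(q)\mid T$, then $$\sum_{k=0}^n(-1)^k\binom nk\left[\begin{matrix} kT+l\\ r\end{matrix}\right]_m(a)\equiv\frac{(a+1)^l}{m}\left(1-(a+1)^T\right)^n \pmod{q^n}.$$
   Context: For $m\in\mathbb{Z}^+$, $N\in\{0,1,2,\ldots\}$, $r\in\mathbb{Z}$ and $a\in\mathbb{Z}$, $\left[\begin{matrix} N\\ r\end{matrix}\right]_m(a)=\sum_{0\le k\le N,\ k\equiv r \pmod m}\binom Nk a^k$ (with $0^0=1$). For integers $q>1$, $m>0$ with $\gcd(q,m)=1$, write $q=\prod_{s=1}^t p_s^{\alpha_s}$ with distinct primes $p_s$ and $\alpha_s\ge1$, and let $\beta_s$ be the multiplicative order of $p_s$ modulo $m$; then $\nu_m(q)=\operatorname{lcm}[p_1^{\alpha_1-1}(p_1^{\beta_1}-1),\ldots,p_t^{\alpha_t-1}(p_t^{\beta_t}-1)]$. Division by $m$ modulo $q^n$ means multiplication by the inverse of $m$ modulo $q^n$. -}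

module Defs where

open import Data.Nat as ℕ using (ℕ; zero; suc; _≤_; _<_)
open import Data.Nat.Combinatorics using (_C_)
open import Data.Nat.Primality using (Prime)
import Data.Nat.Divisibility as ℕD
open import Data.Integer as ℤ using (ℤ; +_; _-_; _*_; -_)
open import Data.Integer.Divisibility using (_∣_)
open import Relation.Nullary using (¬_; Dec; yes; no)
open import Relation.Nullary.Decidable using (⌊_⌋)
open import Data.Bool using (if_then_else_)

sumTo : ℕ → (ℕ → ℤ) → ℤ
sumTo zero    f = f 0
sumTo (suc n) f = sumTo n f ℤ.+ f (suc n)

sumBelow : ℕ → (ℕ → ℤ) → ℤ
sumBelow zero    f = + 0
sumBelow (suc m) f = sumBelow m f ℤ.+ f m

infix 4 _≡_[mod_] _≡ᵏ_[mod_]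
_≡_[mod_] : ℤ → ℤ → ℕ → Set
x ≡ y [mod M ] = (+ M) ∣ (x - y)

_≡ᵏ_[mod_] : ℕ → ℤ → ℕ → Set
k ≡ᵏ r [mod m ] = (+ m) ∣ ((+ k) - r)

≡ᵏ-dec : ∀ k r m → Dec (k ≡ᵏ r [mod m ])
≡ᵏ-dec k r m = m ℕD.∣? ℤ.∣ (+ k) - r ∣

binomMod : (m N : ℕ) (r a : ℤ) → ℤ
binomMod m N r a =
  sumTo N (λ k → if ⌊ ≡ᵏ-dec k r m ⌋ then (+ (N C k)) * (a ℤ.^ k) else + 0)

IsMultOrder : (m p β : ℕ) → Set
IsMultOrder m p β =
  1 ≤ β × ((+ (p ℕ.^ β)) ≡ + 1 [mod m ]) ×
  (∀ γ → 1 ≤ γ → γ < β → ¬ ((+ (p ℕ.^ γ)) ≡ + 1 [mod m ]))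
  where open import Data.Product using (_×_)

-- ν_m(q) ∣ T.  ν_m(q) = lcm over the prime-power factors p^α ∥ q (α ≥ 1)
-- of p^(α-1)(p^β - 1), β = ord_m(p).  An lcm divides T iff each of its
-- arguments does, so this says: for every prime p with p^α ∥ q, α ≥ 1,
-- and β the order of p mod m, p^(α-1)(p^β - 1) ∣ T.
νDivides : (m q T : ℕ) → Set
νDivides m q T =
  ∀ p α β → Prime p → 1 ≤ α → (p ℕ.^ α) ℕD.∣ q → ¬ ((p ℕ.^ suc α) ℕD.∣ q) →
  IsMultOrder m p β →
  ((p ℕ.^ (α ℕ.∸ 1)) ℕ.* ((p ℕ.^ β) ℕ.∸ 1)) ℕD.∣ T

{-# OPTIONS --safe #-}

-- Let S be the shift (S v)(r) = v (r - 1) on integer sequences and U = 1 + a S.  With δ the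
-- indicator of mℤ, [N r]_m(a) = (U^N δ)(r), so the left-hand side is ((1 - U^T)^n U^l δ)(r).
-- Write m δ = 1 + v₀ with v₀ m-periodic of zero sum over a period.  On constants U acts as
-- multiplication by a + 1, so m times the left-hand side is
-- (a + 1)^l (1 - (a + 1)^T)^n + ((1 - U^T)^n U^l v₀)(r), and it remains to show U^T ≡ 1
-- (mod q) on mean-zero periodic sequences.  By the Chinese remainder theorem it suffices to
-- treat p^α ∥ q.  Modulo p, Frobenius gives U^(p^β) ≡ 1 + a^(p^β) S^(p^β), which is U on
-- m-periodic sequences since p^β ≡ 1 (mod m) and a^(p^β) ≡ a.  Because p ∤ m and
-- p ∤ Σ (-a)^j, every mean-zero sequence is modulo p a unit multiple of U w for some
-- m-periodic w, so U^(p^β - 1) ≡ 1 (mod p) on them.  Finally U^K ≡ 1 (mod d) with p ∣ d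
-- implies U^(pK) ≡ 1 (mod dp), which lifts this to U^(p^(α-1) (p^β - 1)) ≡ 1 (mod p^α).

module Submission where

open import Defs
open import Data.Bool using (Bool; true; false; if_then_else_)
open import Data.Nat as ℕ using (ℕ; zero; suc; _≤_; _<_; z≤n; s≤s)
import Data.Nat.Properties as ℕP
import Data.Nat.Divisibility as ℕD
open import Data.Nat.Combinatorics using (_C_; k>n⇒nCk≡0; nCk+nC[k+1]≡[n+1]C[k+1]; nCn≡1)
open import Data.Nat.Coprimality using (Coprime) renaming (sym to coprime-sym)
open import Data.Nat.Primality using (Prime; prime; euclidsLemma; prime⇒nonZero; prime⇒nonTrivial)
open import Data.Product using (Σ; _×_; _,_; proj₁; proj₂)
open import Data.Sum using (inj₁; inj₂)
open import Function.Base using (id; _∘_)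
open import Level using (0ℓ)
open import Relation.Nullary using (¬_; contradiction; yes; no)
open import Relation.Nullary.Decidable using (⌊_⌋)
open import Relation.Binary.PropositionalEquality

module ℕ-NumberTheory where

  open import Data.Nat using (_+_; _*_; _^_; _∸_; NonZero)
  open import Data.Nat.Combinatorics using (nC1≡n)
  open import Data.Nat.Divisibility using (_∣_; _∣?_; divides; ∣-trans; ∣-refl; 1∣_; ∣1⇒≡1; 0∣⇒≡0; *-cancelˡ-∣)
  open import Data.Nat.DivMod using (_%_; _/_; m≡m%n+[m/n]*n; m%n<n)
  open import Data.Nat.LCM using (lcm; lcm-least; gcd*lcm)
  open import Data.Nat.Coprimality using (coprime-divisor; coprime⇒gcd≡1; prime⇒coprime)
  open import Data.Nat.Primality using (prime⇒irreducible)
  open import Data.Nat.Primality.Factorisation using (factorise)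
  open import Data.Nat.Induction using (<-rec)
  import Data.Nat.Tactic.RingSolver as ℕ-Ring
  open import Data.Fin using (Fin; toℕ; fromℕ<)
  open import Data.Fin.Properties using (pigeonhole; toℕ-fromℕ<)
  open import Data.List.Base using ([]; _∷_)
  open import Data.List.Relation.Unary.All using (_∷_)
  open import Data.Nat.ListAction using (product)
  open import Relation.Nullary using (_×-dec_)
  open import Relation.Unary using (Decidable)
  import Data.Integer as ℤ

  [1+k]*[1+n]C[1+k]≡[1+n]*nCk : ∀ n k → suc k * (suc n C suc k) ≡ suc n * (n C k)
  [1+k]*[1+n]C[1+k]≡[1+n]*nCk zero    zero    = refl
  [1+k]*[1+n]C[1+k]≡[1+n]*nCk zero    (suc k) = ℕP.*-zeroʳ (suc (suc k))
  [1+k]*[1+n]C[1+k]≡[1+n]*nCk (suc n) zero    =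
    trans (ℕP.*-identityˡ (suc (suc n) C 1))
          (trans (nC1≡n (suc (suc n))) (sym (ℕP.*-identityʳ (suc (suc n)))))
  [1+k]*[1+n]C[1+k]≡[1+n]*nCk (suc n) (suc k) = begin
    suc (suc k) * (suc (suc n) C suc (suc k))
      ≡⟨ cong (suc (suc k) *_) (sym (nCk+nC[k+1]≡[n+1]C[k+1] (suc n) (suc k))) ⟩
    suc (suc k) * (suc n C suc k + suc n C suc (suc k))
      ≡⟨ split (suc n C suc k) (suc n C suc (suc k)) (suc k) ⟩
    suc k * (suc n C suc k) + suc n C suc k + suc (suc k) * (suc n C suc (suc k))
      ≡⟨ cong₂ (λ x y → x + suc n C suc k + y)
               ([1+k]*[1+n]C[1+k]≡[1+n]*nCk n k) ([1+k]*[1+n]C[1+k]≡[1+n]*nCk n (suc k)) ⟩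
    suc n * (n C k) + suc n C suc k + suc n * (n C suc k)
      ≡⟨ merge (n C k) (n C suc k) (suc n C suc k) (suc n) ⟩
    suc n * (n C k + n C suc k) + suc n C suc k
      ≡⟨ cong (λ x → suc n * x + suc n C suc k) (nCk+nC[k+1]≡[n+1]C[k+1] n k) ⟩
    suc n * (suc n C suc k) + suc n C suc k
      ≡⟨ ℕP.+-comm (suc n * (suc n C suc k)) (suc n C suc k) ⟩
    suc (suc n) * (suc n C suc k) ∎
    where
    open ≡-Reasoning
    split : ∀ x y j → suc j * (x + y) ≡ j * x + x + suc j * y
    split = ℕ-Ring.solve-∀
    merge : ∀ x y z j → j * x + z + j * y ≡ j * (x + y) + z
    merge = ℕ-Ring.solve-∀

  p∣pCk : ∀ {p k} → Prime p → 0 < k → k < p → p ∣ p C k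
  p∣pCk {suc p} {suc k} p-prime _ k<p = coprime-divisor (prime⇒coprime p-prime k<p)
    (divides (p C k) (trans ([1+k]*[1+n]C[1+k]≡[1+n]*nCk p k) (ℕP.*-comm (suc p) (p C k))))

  least-witness : ∀ {ℓ} {P : ℕ → Set ℓ} → Decidable P → ∀ {n} → P n →
                  Σ ℕ λ k → P k × (∀ j → j < k → ¬ P j)
  least-witness {P = P} P? {n} = <-rec (λ n → P n → Σ ℕ λ k → P k × (∀ j → j < k → ¬ P j)) search n
    where
    search : ∀ n → (∀ {k} → k < n → P k → Σ ℕ λ k → P k × (∀ j → j < k → ¬ P j)) →
             P n → Σ ℕ λ k → P k × (∀ j → j < k → ¬ P j)
    search n smaller Pn with ℕP.anyUpTo? P? n
    ... | yes (k , k<n , Pk) = smaller k<n Pk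
    ... | no ∄k            = n , Pn , λ j j<n Pj → ∄k (j , j<n , Pj)

  %≡%⇒∣∸ : ∀ {a b} d .{{_ : NonZero d}} → a % d ≡ b % d → d ∣ b ∸ a
  %≡%⇒∣∸ {a} {b} d a%d≡b%d = divides (b / d ∸ a / d) (begin
    b ∸ a                                      ≡⟨ cong₂ _∸_ (m≡m%n+[m/n]*n b d) (m≡m%n+[m/n]*n a d) ⟩
    (b % d + b / d * d) ∸ (a % d + a / d * d)  ≡⟨ cong (λ t → (b % d + b / d * d) ∸ (t + a / d * d)) a%d≡b%d ⟩
    (b % d + b / d * d) ∸ (b % d + a / d * d)  ≡⟨ ℕP.[m+n]∸[m+o]≡n∸o (b % d) _ _ ⟩
    b / d * d ∸ a / d * d                      ≡⟨ ℕP.*-distribʳ-∸ d (b / d) (a / d) ⟨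
    (b / d ∸ a / d) * d                        ∎)
    where open ≡-Reasoning

  prime∤⇒coprime : ∀ {p n} → Prime p → ¬ (p ∣ n) → Coprime p n
  prime∤⇒coprime p-prime p∤n (d∣p , d∣n) with prime⇒irreducible p-prime d∣p
  ... | inj₁ d≡1    = d≡1
  ... | inj₂ refl   = contradiction d∣n p∤n

  coprime-*ˡ : ∀ {a b c} → Coprime a c → Coprime b c → Coprime (a * b) c
  coprime-*ˡ {a} coprime[a,c] coprime[b,c] (i∣ab , i∣c) =
    coprime[b,c] (coprime-divisor (λ (j∣i , j∣a) → coprime[a,c] (j∣a , ∣-trans j∣i i∣c)) i∣ab , i∣c)

  coprime-^ˡ : ∀ {a c} → Coprime a c → ∀ n → Coprime (a ^ n) c
  coprime-^ˡ coprime[a,c] zero    (i∣1 , _) = ∣1⇒≡1 i∣1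
  coprime-^ˡ coprime[a,c] (suc n) = coprime-*ˡ coprime[a,c] (coprime-^ˡ coprime[a,c] n)

  coprime⇒*∣ : ∀ {a b x} → Coprime a b → a ∣ x → b ∣ x → a * b ∣ x
  coprime⇒*∣ {a} {b} coprime[a,b] a∣x b∣x = subst (_∣ _) lcm≡a*b (lcm-least a∣x b∣x)
    where
    lcm≡a*b : lcm a b ≡ a * b
    lcm≡a*b = trans (sym (ℕP.*-identityˡ (lcm a b)))
                    (trans (cong (_* lcm a b) (sym (coprime⇒gcd≡1 coprime[a,b]))) (gcd*lcm a b))

  prime-factor : ∀ n → .{{_ : ℕ.NonTrivial n}} → Σ ℕ λ p → Prime p × p ∣ n
  prime-factor n@(suc (suc _)) with factorise n
  ... | record { factors = [] ; isFactorisation = () }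
  ... | record { factors = p ∷ ps ; isFactorisation = n≡p*ps ; factorsPrime = p-prime ∷ _ } =
    p , p-prime , divides (product ps) (trans n≡p*ps (ℕP.*-comm p (product ps)))

  p-adic-decomposition : ∀ {p} → Prime p → ∀ n → .{{_ : NonZero n}} →
                         Σ ℕ λ j → Σ ℕ λ e → n ≡ p ^ j * e × ¬ (p ∣ e)
  p-adic-decomposition {p} p-prime n = <-rec P decompose n
    where
    P : ℕ → Set
    P n = .{{_ : NonZero n}} → Σ ℕ λ j → Σ ℕ λ e → n ≡ p ^ j * e × ¬ (p ∣ e)
    decompose : ∀ n → (∀ {k} → k < n → P k) → P n
    decompose n smaller with p ∣? n
    ... | no p∤n = 0 , n , sym (ℕP.+-identityʳ n) , p∤n
    ... | yes (divides zero refl) = contradiction refl (ℕ.≢-nonZero⁻¹ 0)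
    ... | yes (divides k@(suc _) refl) with smaller (ℕP.m<m*n k p (ℕ.nonTrivial⇒n>1 p {{prime⇒nonTrivial p-prime}}))
    ...   | j , e , k≡p^j*e , p∤e = suc j , e , trans (cong (_* p) k≡p^j*e) (rotate (p ^ j) e p) , p∤e
      where
      rotate : ∀ x e p → x * e * p ≡ p * x * e
      rotate = ℕ-Ring.solve-∀

  ^-monoʳ-∣ : ∀ p {i j} → i ≤ j → p ^ i ∣ p ^ j
  ^-monoʳ-∣ p {i} {j} i≤j = divides (p ^ (j ∸ i)) (begin
    p ^ j                 ≡⟨ cong (p ^_) (ℕP.m+[n∸m]≡n i≤j) ⟨
    p ^ (i + (j ∸ i))     ≡⟨ ℕP.^-distribˡ-+-* p i (j ∸ i) ⟩
    p ^ i * p ^ (j ∸ i)   ≡⟨ ℕP.*-comm (p ^ i) (p ^ (j ∸ i)) ⟩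
    p ^ (j ∸ i) * p ^ i   ∎)
    where open ≡-Reasoning

  module _ {p} (p-prime : Prime p) where

    private instance
      p≢0 : NonZero p
      p≢0 = prime⇒nonZero p-prime

    p^[1+α]∤p^α*e : ∀ α {e} → ¬ (p ∣ e) → ¬ (p ^ suc α ∣ p ^ α * e)
    p^[1+α]∤p^α*e α {e} p∤e p^[1+α]∣p^α*e =
      p∤e (*-cancelˡ-∣ (p ^ α) {{ℕP.m^n≢0 p α}} (subst (_∣ p ^ α * e) (ℕP.*-comm p (p ^ α)) p^[1+α]∣p^α*e))

    1≤exponent : ∀ {j e} → p ∣ p ^ j * e → ¬ (p ∣ e) → 1 ≤ j
    1≤exponent {zero}  {e} p∣e p∤e = contradiction (subst (p ∣_) (ℕP.+-identityʳ e) p∣e) p∤e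
    1≤exponent {suc j}     _   _   = s≤s z≤n

    1<p^j : ∀ {j} → 1 ≤ j → 1 < p ^ j
    1<p^j {suc j} _ = ℕP.<-≤-trans (ℕ.nonTrivial⇒n>1 p {{prime⇒nonTrivial p-prime}})
                                   (ℕP.m≤m*n p (p ^ j) {{ℕP.m^n≢0 p j}})

    p^j∣p^α*e⇒j≤α : ∀ {j α e} → ¬ (p ∣ e) → p ^ j ∣ p ^ α * e → j ≤ α
    p^j∣p^α*e⇒j≤α {j} {α} p∤e p^j∣ with j ℕP.≤? α
    ... | yes j≤α = j≤α
    ... | no  j≰α = contradiction (∣-trans (^-monoʳ-∣ p (ℕP.≰⇒> j≰α)) p^j∣) (p^[1+α]∤p^α*e α p∤e)

  -- Strong induction over the divisors d of q, splitting d = p^j e with p ∤ e.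
  ∣-from-exact-prime-powers : ∀ q .{{_ : NonZero q}} x →
    (∀ {p α} → Prime p → 1 ≤ α → p ^ α ∣ q → ¬ (p ^ suc α ∣ q) → p ^ α ∣ x) → q ∣ x
  ∣-from-exact-prime-powers q x exact⇒∣x = <-rec (λ d → d ∣ q → d ∣ x) divides-x q ∣-refl
    where
    divides-x : ∀ d → (∀ {e} → e < d → e ∣ q → e ∣ x) → d ∣ q → d ∣ x
    divides-x 0               _       0∣q = contradiction (0∣⇒≡0 0∣q) (ℕ.≢-nonZero⁻¹ q)
    divides-x 1               _       _   = 1∣ x
    divides-x d@(suc (suc _)) smaller d∣q with prime-factor d
    ... | p , p-prime , p∣d with p-adic-decomposition p-prime d | p-adic-decomposition p-prime q
    ... | j , e , d≡p^j*e , p∤e | α , e′ , q≡p^α*e′ , p∤e′ =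
      subst (_∣ x) (sym d≡p^j*e) (coprime⇒*∣ (coprime-^ˡ (prime∤⇒coprime p-prime p∤e) j) p^j∣x e∣x)
      where
      instance
        p≢0 : NonZero p
        p≢0 = prime⇒nonZero p-prime
      p^j∣d : p ^ j ∣ d
      p^j∣d = divides e (trans d≡p^j*e (ℕP.*-comm (p ^ j) e))
      j≤α : j ≤ α
      j≤α = p^j∣p^α*e⇒j≤α p-prime p∤e′ (subst (p ^ j ∣_) q≡p^α*e′ (∣-trans p^j∣d d∣q))
      1≤j : 1 ≤ j
      1≤j = 1≤exponent p-prime (subst (p ∣_) d≡p^j*e p∣d) p∤e
      p^j∣x : p ^ j ∣ x
      p^j∣x = ∣-trans (^-monoʳ-∣ p j≤α)
                      (exact⇒∣x p-prime (ℕP.≤-trans 1≤j j≤α) (divides e′ (trans q≡p^α*e′ (ℕP.*-comm (p ^ α) e′)))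
                                (subst (λ n → ¬ (p ^ suc α ∣ n)) (sym q≡p^α*e′) (p^[1+α]∤p^α*e p-prime α p∤e′)))
      e<d : e < d
      e<d = subst (e <_) (trans (ℕP.*-comm e (p ^ j)) (sym d≡p^j*e))
                  (ℕP.m<m*n e (p ^ j) {{ℕP.m*n≢0⇒n≢0 (p ^ j) {{subst NonZero d≡p^j*e _}}}} (1<p^j p-prime 1≤j))
      e∣x : e ∣ x
      e∣x = smaller e<d (∣-trans (divides (p ^ j) d≡p^j*e) d∣q)

  -- Pigeonhole on p^0, …, p^m modulo m.
  power≡1-exists : ∀ {m p} .{{_ : NonZero m}} → Coprime m p → Σ ℕ λ γ → 1 ≤ γ × m ∣ p ^ γ ∸ 1
  power≡1-exists {m} {p} coprime[m,p]
    with i , j , i<j , residue[i]≡residue[j]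
           ← pigeonhole (ℕP.n<1+n m) (λ (i : Fin (suc m)) → fromℕ< (m%n<n (p ^ toℕ i) m))
    = toℕ j ∸ toℕ i , ℕP.m<n⇒0<n∸m i<j , m∣p^γ∸1
    where
    I = toℕ i
    γ = toℕ j ∸ toℕ i
    residues : p ^ I % m ≡ p ^ toℕ j % m
    residues = trans (sym (toℕ-fromℕ< (m%n<n (p ^ I) m)))
                     (trans (cong toℕ residue[i]≡residue[j]) (toℕ-fromℕ< (m%n<n (p ^ toℕ j) m)))
    factor : p ^ toℕ j ∸ p ^ I ≡ p ^ I * (p ^ γ ∸ 1)
    factor = begin
      p ^ toℕ j ∸ p ^ I                 ≡⟨ cong (λ n → p ^ n ∸ p ^ I) (ℕP.m+[n∸m]≡n (ℕP.<⇒≤ i<j)) ⟨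
      p ^ (I + γ) ∸ p ^ I               ≡⟨ cong₂ _∸_ (ℕP.^-distribˡ-+-* p I γ) (sym (ℕP.*-identityʳ (p ^ I))) ⟩
      p ^ I * p ^ γ ∸ p ^ I * 1         ≡⟨ ℕP.*-distribˡ-∸ (p ^ I) (p ^ γ) 1 ⟨
      p ^ I * (p ^ γ ∸ 1)               ∎
      where open ≡-Reasoning
    m∣p^γ∸1 : m ∣ p ^ γ ∸ 1
    m∣p^γ∸1 = coprime-divisor (coprime-sym (coprime-^ˡ (coprime-sym coprime[m,p]) I))
                              (subst (m ∣_) factor (%≡%⇒∣∸ m residues))

  ∣+n-1∣≡n∸1 : ∀ n → .{{_ : NonZero n}} → ℤ.∣ ℤ.+ n ℤ.- ℤ.1ℤ ∣ ≡ n ∸ 1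
  ∣+n-1∣≡n∸1 (suc n) = refl

  multiplicative-order : ∀ {m p} .{{_ : NonZero m}} .{{_ : NonZero p}} → Coprime m p → Σ ℕ (IsMultOrder m p)
  multiplicative-order {m} {p} coprime[m,p] = from-power (power≡1-exists coprime[m,p])
    where
    Q : ℕ → Set
    Q γ = 1 ≤ γ × ℤ.+ (p ^ γ) ≡ ℤ.+ 1 [mod m ]
    Q? : Decidable Q
    Q? γ = (1 ℕP.≤? γ) ×-dec (m ∣? ℤ.∣ ℤ.+ (p ^ γ) ℤ.- ℤ.+ 1 ∣)
    from-power : (Σ ℕ λ γ → 1 ≤ γ × m ∣ p ^ γ ∸ 1) → Σ ℕ (IsMultOrder m p)
    from-power (γ , 1≤γ , m∣p^γ∸1)
      with β , (1≤β , p^β≡1) , minimal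
             ← least-witness Q? (1≤γ , subst (m ∣_) (sym (∣+n-1∣≡n∸1 (p ^ γ) {{ℕP.m^n≢0 p γ}})) m∣p^γ∸1)
      = β , 1≤β , p^β≡1 , λ δ 1≤δ δ<β p^δ≡1 → minimal δ δ<β (1≤δ , p^δ≡1)

open ℕ-NumberTheory

open import Data.Integer as ℤ using (ℤ; +_; -_; _*_; _-_; _+_; 0ℤ; 1ℤ; _^_; ∣_∣)
import Data.Integer.Properties as ℤP
open import Data.Integer.Divisibility.Signed
  using (_∣_; divides; _∣?_; ∣m∣n⇒∣m+n; ∣m∣n⇒∣m-n; ∣m⇒∣m*n; ∣n⇒∣m*n; ∣m⇒∣-m; *-monoʳ-∣; ∣-trans; ∣ᵤ⇒∣; ∣⇒∣ᵤ)
open import Data.Integer.Tactic.RingSolver using (solve-∀)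
open import Relation.Binary.Bundles using (Setoid)
import Relation.Binary.Reasoning.Setoid as SetoidReasoning

sumTo-cong : ∀ N {f g : ℕ → ℤ} → (∀ k → f k ≡ g k) → sumTo N f ≡ sumTo N g
sumTo-cong zero    f≗g = f≗g 0
sumTo-cong (suc N) f≗g = cong₂ _+_ (sumTo-cong N f≗g) (f≗g (suc N))

sumTo-distrib-+ : ∀ N (f g : ℕ → ℤ) → sumTo N (λ k → f k + g k) ≡ sumTo N f + sumTo N g
sumTo-distrib-+ zero    f g = refl
sumTo-distrib-+ (suc N) f g = begin
  sumTo N (λ k → f k + g k) + (f (suc N) + g (suc N))
    ≡⟨ cong (_+ (f (suc N) + g (suc N))) (sumTo-distrib-+ N f g) ⟩
  (sumTo N f + sumTo N g) + (f (suc N) + g (suc N))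
    ≡⟨ interchange (sumTo N f) (sumTo N g) (f (suc N)) (g (suc N)) ⟩
  (sumTo N f + f (suc N)) + (sumTo N g + g (suc N)) ∎
  where
  open ≡-Reasoning
  interchange : ∀ a b c d → (a + b) + (c + d) ≡ (a + c) + (b + d)
  interchange = solve-∀

*-distribˡ-sumTo : ∀ N c (f : ℕ → ℤ) → c * sumTo N f ≡ sumTo N (λ k → c * f k)
*-distribˡ-sumTo zero    c f = refl
*-distribˡ-sumTo (suc N) c f = trans (ℤP.*-distribˡ-+ c (sumTo N f) (f (suc N)))
                                     (cong (_+ c * f (suc N)) (*-distribˡ-sumTo N c f))

sumTo-suc : ∀ N (f : ℕ → ℤ) → sumTo (suc N) f ≡ f 0 + sumTo N (λ k → f (suc k))
sumTo-suc zero    f = refl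
sumTo-suc (suc N) f = trans (cong (_+ f (suc (suc N))) (sumTo-suc N f))
                            (ℤP.+-assoc (f 0) (sumTo N (λ k → f (suc k))) (f (suc (suc N))))

sumTo-pascal : ∀ N (g : ℕ → ℤ) →
  sumTo (suc N) (λ k → + (suc N C k) * g k)
    ≡ sumTo N (λ k → + (N C k) * g k) + sumTo N (λ k → + (N C k) * g (suc k))
sumTo-pascal N g = begin
  sumTo (suc N) (λ k → + (suc N C k) * g k)
    ≡⟨ sumTo-suc N _ ⟩
  g₀ + sumTo N (λ k → + (suc N C suc k) * g (suc k))
    ≡⟨ cong (λ s → g₀ + s) (sumTo-cong N pascal-term) ⟩
  g₀ + sumTo N (λ k → + (N C suc k) * g (suc k) + + (N C k) * g (suc k))
    ≡⟨ cong (λ s → g₀ + s) (sumTo-distrib-+ N _ _) ⟩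
  g₀ + (sumTo N (λ k → + (N C suc k) * g (suc k)) + B)
    ≡⟨ ℤP.+-assoc g₀ _ B ⟨
  (g₀ + sumTo N (λ k → + (N C suc k) * g (suc k))) + B
    ≡⟨ cong (_+ B) (sumTo-suc N (λ k → + (N C k) * g k)) ⟨
  sumTo (suc N) (λ k → + (N C k) * g k) + B
    ≡⟨ cong (λ c → sumTo N (λ k → + (N C k) * g k) + + c * g (suc N) + B) (k>n⇒nCk≡0 (ℕP.n<1+n N)) ⟩
  sumTo N (λ k → + (N C k) * g k) + 0ℤ + B
    ≡⟨ cong (_+ B) (ℤP.+-identityʳ (sumTo N (λ k → + (N C k) * g k))) ⟩
  sumTo N (λ k → + (N C k) * g k) + B ∎
  where
  open ≡-Reasoning
  g₀ = 1ℤ * g 0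
  B = sumTo N (λ k → + (N C k) * g (suc k))
  pascal-term : ∀ k → + (suc N C suc k) * g (suc k) ≡ + (N C suc k) * g (suc k) + + (N C k) * g (suc k)
  pascal-term k = begin
    + (suc N C suc k) * g (suc k)
      ≡⟨ cong (λ c → + c * g (suc k)) (trans (sym (nCk+nC[k+1]≡[n+1]C[k+1] N k)) (ℕP.+-comm (N C k) _)) ⟩
    + (N C suc k ℕ.+ N C k) * g (suc k)
      ≡⟨ cong (_* g (suc k)) (ℤP.pos-+ (N C suc k) (N C k)) ⟩
    (+ (N C suc k) + + (N C k)) * g (suc k)
      ≡⟨ ℤP.*-distribʳ-+ (g (suc k)) (+ (N C suc k)) (+ (N C k)) ⟩
    + (N C suc k) * g (suc k) + + (N C k) * g (suc k) ∎

sumTo-∣ : ∀ {d} N (f : ℕ → ℤ) → (∀ k → k ≤ N → d ∣ f k) → d ∣ sumTo N f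
sumTo-∣ zero    f d∣f = d∣f 0 z≤n
sumTo-∣ (suc N) f d∣f =
  ∣m∣n⇒∣m+n (sumTo-∣ N f (λ k k≤N → d∣f k (ℕP.m≤n⇒m≤1+n k≤N))) (d∣f (suc N) ℕP.≤-refl)

sumBelow-cong : ∀ N {f g : ℕ → ℤ} → (∀ k → f k ≡ g k) → sumBelow N f ≡ sumBelow N g
sumBelow-cong zero    f≗g = refl
sumBelow-cong (suc N) f≗g = cong₂ _+_ (sumBelow-cong N f≗g) (f≗g N)

sumBelow-distrib-+ : ∀ N (f g : ℕ → ℤ) → sumBelow N (λ k → f k + g k) ≡ sumBelow N f + sumBelow N g
sumBelow-distrib-+ zero    f g = refl
sumBelow-distrib-+ (suc N) f g = begin
  sumBelow N (λ k → f k + g k) + (f N + g N)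
    ≡⟨ cong (_+ (f N + g N)) (sumBelow-distrib-+ N f g) ⟩
  (sumBelow N f + sumBelow N g) + (f N + g N)
    ≡⟨ interchange (sumBelow N f) (sumBelow N g) (f N) (g N) ⟩
  (sumBelow N f + f N) + (sumBelow N g + g N) ∎
  where
  open ≡-Reasoning
  interchange : ∀ a b c d → (a + b) + (c + d) ≡ (a + c) + (b + d)
  interchange = solve-∀

*-distribˡ-sumBelow : ∀ N c (f : ℕ → ℤ) → c * sumBelow N f ≡ sumBelow N (λ k → c * f k)
*-distribˡ-sumBelow zero    c f = ℤP.*-zeroʳ c
*-distribˡ-sumBelow (suc N) c f = trans (ℤP.*-distribˡ-+ c (sumBelow N f) (f N))
                                        (cong (_+ c * f N) (*-distribˡ-sumBelow N c f))

sumBelow-suc : ∀ N (f : ℕ → ℤ) → sumBelow (suc N) f ≡ f 0 + sumBelow N (λ k → f (suc k))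
sumBelow-suc zero    f = ℤP.+-comm 0ℤ (f 0)
sumBelow-suc (suc N) f = trans (cong (_+ f (suc N)) (sumBelow-suc N f))
                               (ℤP.+-assoc (f 0) (sumBelow N (λ k → f (suc k))) (f (suc N)))

sumBelow-telescope : ∀ N (f : ℕ → ℤ) → sumBelow N (λ k → f (suc k) - f k) ≡ f N - f 0
sumBelow-telescope zero    f = sym (ℤP.+-inverseʳ (f 0))
sumBelow-telescope (suc N) f =
  trans (cong (_+ (f (suc N) - f N)) (sumBelow-telescope N f)) (telescope (f 0) (f N) (f (suc N)))
  where
  telescope : ∀ a b c → b - a + (c - b) ≡ c - a
  telescope = solve-∀

sumBelow-const : ∀ N c → sumBelow N (λ _ → c) ≡ + N * c
sumBelow-const zero    c = refl
sumBelow-const (suc N) c = begin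
  sumBelow N (λ _ → c) + c  ≡⟨ cong (_+ c) (sumBelow-const N c) ⟩
  + N * c + c               ≡⟨ add-one (+ N) c ⟩
  (1ℤ + + N) * c            ∎
  where
  open ≡-Reasoning
  add-one : ∀ n c → n * c + c ≡ (1ℤ + n) * c
  add-one = solve-∀

sumBelow-zero : ∀ N {f : ℕ → ℤ} → (∀ k → k < N → f k ≡ 0ℤ) → sumBelow N f ≡ 0ℤ
sumBelow-zero zero    f≡0 = refl
sumBelow-zero (suc N) f≡0 =
  cong₂ _+_ (sumBelow-zero N (λ k k<N → f≡0 k (ℕP.m<n⇒m<1+n k<N))) (f≡0 N ℕP.≤-refl)

sumBelow-slide : ∀ M (v : ℤ → ℤ) r →
  sumBelow M (λ j → v (1ℤ + r - + j)) ≡ v (1ℤ + r) - v (1ℤ + r - + M) + sumBelow M (λ j → v (r - + j))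
sumBelow-slide zero    v r = begin
  0ℤ                                  ≡⟨ ℤP.+-inverseʳ (v (1ℤ + r)) ⟨
  v (1ℤ + r) - v (1ℤ + r)             ≡⟨ cong (λ t → v (1ℤ + r) - v t) (ℤP.+-identityʳ (1ℤ + r)) ⟨
  v (1ℤ + r) - v (1ℤ + r - + 0)       ≡⟨ ℤP.+-identityʳ _ ⟨
  v (1ℤ + r) - v (1ℤ + r - + 0) + 0ℤ  ∎
  where open ≡-Reasoning
sumBelow-slide (suc M) v r = begin
  sumBelow M (λ j → v (1ℤ + r - + j)) + v (1ℤ + r - + M)
    ≡⟨ cong (_+ v (1ℤ + r - + M)) (sumBelow-slide M v r) ⟩
  v (1ℤ + r) - v (1ℤ + r - + M) + W + v (1ℤ + r - + M)
    ≡⟨ collapse (v (1ℤ + r)) (v (1ℤ + r - + M)) W (v (r - + M)) ⟩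
  v (1ℤ + r) - v (r - + M) + (W + v (r - + M))
    ≡⟨ cong (λ t → v (1ℤ + r) - v t + (W + v (r - + M))) (shift-index r (+ M)) ⟩
  v (1ℤ + r) - v (1ℤ + r - + suc M) + (W + v (r - + M)) ∎
  where
  open ≡-Reasoning
  W = sumBelow M (λ j → v (r - + j))
  collapse : ∀ a b W c → a - b + W + b ≡ a - c + (W + c)
  collapse = solve-∀
  shift-index : ∀ r M → r - M ≡ 1ℤ + r - (1ℤ + M)
  shift-index = solve-∀

-- A record rather than a synonym for d ∣ x - y, so that x, y and d can be inferred.
infix 4 _≡_⟨mod_⟩
record _≡_⟨mod_⟩ (x y d : ℤ) : Set where
  constructor mk≡mod
  field ∣-difference : d ∣ x - y
open _≡_⟨mod_⟩ public

≡⇒≡mod : ∀ {x y d} → x ≡ y → x ≡ y ⟨mod d ⟩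
≡⇒≡mod {x} refl = mk≡mod (divides 0ℤ (ℤP.+-inverseʳ x))

≡mod-sym : ∀ {x y d} → x ≡ y ⟨mod d ⟩ → y ≡ x ⟨mod d ⟩
≡mod-sym {x} {y} {d} (mk≡mod (divides k eq)) = mk≡mod (divides (- k) (begin
  y - x       ≡⟨ swap x y ⟩
  - (x - y)   ≡⟨ cong -_ eq ⟩
  - (k * d)   ≡⟨ ℤP.neg-distribˡ-* k d ⟩
  - k * d     ∎))
  where
  open ≡-Reasoning
  swap : ∀ x y → y - x ≡ - (x - y)
  swap = solve-∀

≡mod-trans : ∀ {x y z d} → x ≡ y ⟨mod d ⟩ → y ≡ z ⟨mod d ⟩ → x ≡ z ⟨mod d ⟩
≡mod-trans {x} {y} {z} {d} (mk≡mod d∣x-y) (mk≡mod d∣y-z) =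
  mk≡mod (subst (d ∣_) (telescope x y z) (∣m∣n⇒∣m+n d∣x-y d∣y-z))
  where
  telescope : ∀ x y z → (x - y) + (y - z) ≡ x - z
  telescope = solve-∀

≡mod-setoid : ℤ → Setoid 0ℓ 0ℓ
≡mod-setoid d = record
  { Carrier       = ℤ
  ; _≈_           = λ x y → x ≡ y ⟨mod d ⟩
  ; isEquivalence = record { refl = ≡⇒≡mod refl ; sym = ≡mod-sym ; trans = ≡mod-trans }
  }

module ≡mod-Reasoning (d : ℤ) = SetoidReasoning (≡mod-setoid d)

≡mod-quotient : ∀ {x y d} → x ≡ y ⟨mod d ⟩ → ℤ
≡mod-quotient x≡y = _∣_.quotient (∣-difference x≡y)

≡mod-decompose : ∀ {x y d} (x≡y : x ≡ y ⟨mod d ⟩) → x ≡ 1ℤ * y + d * ≡mod-quotient x≡y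
≡mod-decompose {x} {y} {d} x≡y = begin
  x                       ≡⟨ split x y ⟩
  1ℤ * y + (x - y)        ≡⟨ cong (λ t → 1ℤ * y + t) (_∣_.equality (∣-difference x≡y)) ⟩
  1ℤ * y + z * d          ≡⟨ cong (λ t → 1ℤ * y + t) (ℤP.*-comm z d) ⟩
  1ℤ * y + d * z          ∎
  where
  open ≡-Reasoning
  z = ≡mod-quotient x≡y
  split : ∀ a b → a ≡ 1ℤ * b + (a - b)
  split = solve-∀

≡mod-+ : ∀ {x x′ y y′ d} → x ≡ x′ ⟨mod d ⟩ → y ≡ y′ ⟨mod d ⟩ → x + y ≡ x′ + y′ ⟨mod d ⟩
≡mod-+ {x} {x′} {y} {y′} {d} (mk≡mod d∣x-x′) (mk≡mod d∣y-y′) =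
  mk≡mod (subst (d ∣_) (interchange x x′ y y′) (∣m∣n⇒∣m+n d∣x-x′ d∣y-y′))
  where
  interchange : ∀ x x′ y y′ → (x - x′) + (y - y′) ≡ (x + y) - (x′ + y′)
  interchange = solve-∀

≡mod-cancel-+ˡ : ∀ {x y d} c → c + x ≡ c + y ⟨mod d ⟩ → x ≡ y ⟨mod d ⟩
≡mod-cancel-+ˡ {x} {y} {d} c (mk≡mod d∣difference) = mk≡mod (subst (d ∣_) (cancel c x y) d∣difference)
  where
  cancel : ∀ c x y → (c + x) - (c + y) ≡ x - y
  cancel = solve-∀

≡mod-weaken : ∀ {x y d e} → e ∣ d → x ≡ y ⟨mod d ⟩ → x ≡ y ⟨mod e ⟩
≡mod-weaken e∣d (mk≡mod d∣x-y) = mk≡mod (∣-trans e∣d d∣x-y)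

≡mod-∣ : ∀ {x y d} → x ≡ y ⟨mod d ⟩ → d ∣ y → d ∣ x
≡mod-∣ {x} {y} {d} (mk≡mod d∣x-y) d∣y = subst (d ∣_) (restore x y) (∣m∣n⇒∣m+n d∣x-y d∣y)
  where
  restore : ∀ x y → x - y + y ≡ x
  restore = solve-∀

≡mod-+-multiple : ∀ {x y d} → d ∣ y → x + y ≡ x ⟨mod d ⟩
≡mod-+-multiple {x} {y} {d} d∣y = mk≡mod (subst (d ∣_) (sym (cancel x y)) d∣y)
  where
  cancel : ∀ x y → x + y - x ≡ y
  cancel = solve-∀

≡mod-*ˡ : ∀ {x y d} c → x ≡ y ⟨mod d ⟩ → c * x ≡ c * y ⟨mod d ⟩
≡mod-*ˡ {x} {y} {d} c (mk≡mod d∣x-y) = mk≡mod (subst (d ∣_) (distrib c x y) (∣n⇒∣m*n c d∣x-y))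
  where
  distrib : ∀ c x y → c * (x - y) ≡ c * x - c * y
  distrib = solve-∀

≡mod-*ʳ : ∀ {x y d} c → x ≡ y ⟨mod d ⟩ → x * c ≡ y * c ⟨mod d ⟩
≡mod-*ʳ {x} {y} c x≡y = subst₂ (λ s t → s ≡ t ⟨mod _ ⟩) (ℤP.*-comm c x) (ℤP.*-comm c y) (≡mod-*ˡ c x≡y)

≡mod-*-inverse : ∀ {c c⁻¹ x y d} → c * c⁻¹ ≡ 1ℤ ⟨mod d ⟩ → c * x ≡ y ⟨mod d ⟩ → x ≡ c⁻¹ * y ⟨mod d ⟩
≡mod-*-inverse {c} {c⁻¹} {x} {y} {d} (mk≡mod d∣cc⁻¹-1) (mk≡mod d∣cx-y) =
  mk≡mod (subst (d ∣_) (sym (regroup x y c c⁻¹)) (∣m∣n⇒∣m+n (∣n⇒∣m*n (- x) d∣cc⁻¹-1) (∣n⇒∣m*n c⁻¹ d∣cx-y)))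
  where
  regroup : ∀ x y c c⁻¹ → x - c⁻¹ * y ≡ - x * (c * c⁻¹ - 1ℤ) + c⁻¹ * (c * x - y)
  regroup = solve-∀

p∣c*z∧p∤c⇒p∣z : ∀ {p c z} → Prime p → ¬ (+ p ∣ c) → + p ∣ c * z → + p ∣ z
p∣c*z∧p∤c⇒p∣z {p} {c} {z} p-prime p∤c p∣cz
  with euclidsLemma ℤ.∣ c ∣ ℤ.∣ z ∣ p-prime (subst (p ℕD.∣_) (ℤP.abs-* c z) (∣⇒∣ᵤ p∣cz))
... | inj₁ p∣c = contradiction (∣ᵤ⇒∣ p∣c) p∤c
... | inj₂ p∣z = ∣ᵤ⇒∣ p∣z

≡mod-cancelˡ : ∀ {x y c p} → Prime p → ¬ (+ p ∣ c) → c * x ≡ c * y ⟨mod + p ⟩ → x ≡ y ⟨mod + p ⟩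
≡mod-cancelˡ {x} {y} {c} {p} p-prime p∤c (mk≡mod p∣cx-cy) =
  mk≡mod (p∣c*z∧p∤c⇒p∣z p-prime p∤c (subst (+ p ∣_) (factor c x y) p∣cx-cy))
  where
  factor : ∀ c x y → c * x - c * y ≡ c * (x - y)
  factor = solve-∀

sumBelow-≡mod : ∀ {d} N {f g : ℕ → ℤ} → (∀ k → f k ≡ g k ⟨mod d ⟩) → sumBelow N f ≡ sumBelow N g ⟨mod d ⟩
sumBelow-≡mod zero    f≡g = ≡⇒≡mod refl
sumBelow-≡mod (suc N) f≡g = ≡mod-+ (sumBelow-≡mod N f≡g) (f≡g N)

-- Linear operators on integer sequences

Seq : Set
Seq = ℤ → ℤ

open import Function.Endo.Propositional Seq using (Endo; ∘-id-monoid; ^-homo) renaming (_^_ to _^ᵒ_)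
open import Algebra.Properties.Monoid.Mult ∘-id-monoid using (×-assocˡ)

IsLinear : Endo → Set
IsLinear A = ∀ c d {u v w : Seq} → (∀ x → u x ≡ c * v x + d * w x) →
             ∀ x → A u x ≡ c * A v x + d * A w x

module _ {A : Endo} (A-linear : IsLinear A) where

  linear-scale : ∀ c {u v : Seq} → (∀ x → u x ≡ c * v x) → ∀ x → A u x ≡ c * A v x
  linear-scale c {u} {v} u≡cv x =
    trans (A-linear c 0ℤ {w = v} (λ y → trans (u≡cv y) (sym (ℤP.+-identityʳ (c * v y)))) x)
          (ℤP.+-identityʳ (c * A v x))

  linear-cong : ∀ {u v : Seq} → (∀ x → u x ≡ v x) → ∀ x → A u x ≡ A v x
  linear-cong {u} {v} u≡v x =
    trans (linear-scale 1ℤ (λ y → trans (u≡v y) (sym (ℤP.*-identityˡ (v y)))) x)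
          (ℤP.*-identityˡ (A v x))

  linear-≡mod : ∀ {d} {v w : Seq} → (∀ x → v x ≡ w x ⟨mod d ⟩) → ∀ x → A v x ≡ A w x ⟨mod d ⟩
  linear-≡mod {d} {v} {w} v≡w x = mk≡mod (divides (A z x) (begin
    A v x - A w x                    ≡⟨ cong (_- A w x) (A-linear 1ℤ d (λ y → ≡mod-decompose (v≡w y)) x) ⟩
    1ℤ * A w x + d * A z x - A w x   ≡⟨ cancel (A w x) (A z x) d ⟩
    A z x * d                        ∎))
    where
    open ≡-Reasoning
    z : Seq
    z y = ≡mod-quotient (v≡w y)
    cancel : ∀ a b d → 1ℤ * a + d * b - a ≡ b * d
    cancel = solve-∀

shift : Endo
shift v r = v (r - 1ℤ)

infix 8 I+_·_
I+_·_ : ℤ → Endo → Endo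
(I+ b · A) v r = v r + b * A v r

id-linear : IsLinear id
id-linear c d u≡cv+dw = u≡cv+dw

shift-linear : IsLinear shift
shift-linear c d u≡cv+dw x = u≡cv+dw (x - 1ℤ)

I+·-linear : ∀ b {A} → IsLinear A → IsLinear (I+ b · A)
I+·-linear b {A} A-linear c d {u} {v} {w} u≡cv+dw x = begin
  u x + b * A u x
    ≡⟨ cong₂ (λ s t → s + b * t) (u≡cv+dw x) (A-linear c d u≡cv+dw x) ⟩
  (c * v x + d * w x) + b * (c * A v x + d * A w x)
    ≡⟨ regroup (v x) (w x) (A v x) (A w x) b c d ⟩
  c * (v x + b * A v x) + d * (w x + b * A w x) ∎
  where
  open ≡-Reasoning
  regroup : ∀ v w Av Aw b c d →
    (c * v + d * w) + b * (c * Av + d * Aw) ≡ c * (v + b * Av) + d * (w + b * Aw)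
  regroup = solve-∀

^ᵒ-linear : ∀ {A} → IsLinear A → ∀ N → IsLinear (A ^ᵒ N)
^ᵒ-linear A-linear zero    c d u≡cv+dw = u≡cv+dw
^ᵒ-linear A-linear (suc N) c d u≡cv+dw = A-linear c d (^ᵒ-linear A-linear N c d u≡cv+dw)

∘-linear : ∀ {A B} → IsLinear A → IsLinear B → IsLinear (A ∘ B)
∘-linear A-linear B-linear c d u≡cv+dw = A-linear c d (B-linear c d u≡cv+dw)

^ᵒ-+ : ∀ (f : Endo) M N v → (f ^ᵒ (M ℕ.+ N)) v ≡ (f ^ᵒ M) ((f ^ᵒ N) v)
^ᵒ-+ f M N v = cong-app (^-homo f M N) v

^ᵒ-sucʳ : ∀ (f : Endo) N v → (f ^ᵒ suc N) v ≡ (f ^ᵒ N) (f v)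
^ᵒ-sucʳ f N v = trans (cong (λ k → (f ^ᵒ k) v) (ℕP.+-comm 1 N)) (^ᵒ-+ f N 1 v)

^ᵒ-* : ∀ (f : Endo) M N → (f ^ᵒ N) ^ᵒ M ≡ f ^ᵒ (M ℕ.* N)
^ᵒ-* f M N = ×-assocˡ f M N

id-^ᵒ : ∀ N (v : Seq) → (id ^ᵒ N) v ≡ v
id-^ᵒ zero    v = refl
id-^ᵒ (suc N) v = id-^ᵒ N v

shift-^ᵒ : ∀ N (v : Seq) r → (shift ^ᵒ N) v r ≡ v (r - + N)
shift-^ᵒ zero    v r = cong v (sym (ℤP.+-identityʳ r))
shift-^ᵒ (suc N) v r = trans (shift-^ᵒ N v (r - 1ℤ)) (cong v (step r (+ N)))
  where
  step : ∀ r n → r - 1ℤ - n ≡ r - (1ℤ + n)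
  step = solve-∀

^ᵒ-eigen : ∀ {A} → IsLinear A → ∀ {v} λ′ → (∀ x → A v x ≡ λ′ * v x) →
           ∀ N x → (A ^ᵒ N) v x ≡ λ′ ^ N * v x
^ᵒ-eigen A-linear {v} λ′ Av≡λv zero    x = sym (ℤP.*-identityˡ (v x))
^ᵒ-eigen {A} A-linear {v} λ′ Av≡λv (suc N) x = begin
  A ((A ^ᵒ N) v) x     ≡⟨ linear-scale A-linear (λ′ ^ N) (^ᵒ-eigen A-linear λ′ Av≡λv N) x ⟩
  λ′ ^ N * A v x        ≡⟨ cong (λ′ ^ N *_) (Av≡λv x) ⟩
  λ′ ^ N * (λ′ * v x)   ≡⟨ reassoc (λ′ ^ N) λ′ (v x) ⟩
  λ′ * λ′ ^ N * v x     ∎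
  where
  open ≡-Reasoning
  reassoc : ∀ a b c → a * (b * c) ≡ b * a * c
  reassoc = solve-∀

I+·^ᵒ-binomial : ∀ b {A} → IsLinear A → ∀ N v r →
  ((I+ b · A) ^ᵒ N) v r ≡ sumTo N (λ k → + (N C k) * (b ^ k * (A ^ᵒ k) v r))
I+·^ᵒ-binomial b {A} A-linear zero    v r =
  sym (trans (ℤP.*-identityˡ (1ℤ * v r)) (ℤP.*-identityˡ (v r)))
I+·^ᵒ-binomial b {A} A-linear (suc N) v r = begin
  (B ^ᵒ suc N) v r
    ≡⟨ cong-app (^ᵒ-sucʳ B N v) r ⟩
  (B ^ᵒ N) (B v) r
    ≡⟨ ^ᵒ-linear (I+·-linear b A-linear) N 1ℤ b
                 (λ x → cong (_+ b * A v x) (sym (ℤP.*-identityˡ (v x)))) r ⟩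
  1ℤ * (B ^ᵒ N) v r + b * (B ^ᵒ N) (A v) r
    ≡⟨ cong₂ (λ s t → 1ℤ * s + b * t) (I+·^ᵒ-binomial b A-linear N v r)
                                      (I+·^ᵒ-binomial b A-linear N (A v) r) ⟩
  1ℤ * sumTo N (λ k → + (N C k) * g k)
    + b * sumTo N (λ k → + (N C k) * (b ^ k * (A ^ᵒ k) (A v) r))
    ≡⟨ cong₂ _+_ (ℤP.*-identityˡ (sumTo N (λ k → + (N C k) * g k)))
                 (trans (*-distribˡ-sumTo N b _) (sumTo-cong N raise)) ⟩
  sumTo N (λ k → + (N C k) * g k) + sumTo N (λ k → + (N C k) * g (suc k))
    ≡⟨ sumTo-pascal N g ⟨
  sumTo (suc N) (λ k → + (suc N C k) * g k) ∎
  where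
  open ≡-Reasoning
  B = I+ b · A
  g : ℕ → ℤ
  g k = b ^ k * (A ^ᵒ k) v r
  reassoc : ∀ b c e x → b * (c * (e * x)) ≡ c * (b * e * x)
  reassoc = solve-∀
  raise : ∀ k → b * (+ (N C k) * (b ^ k * (A ^ᵒ k) (A v) r)) ≡ + (N C k) * g (suc k)
  raise k = trans (reassoc b (+ (N C k)) (b ^ k) _)
                  (cong (λ t → + (N C k) * (b * b ^ k * t)) (sym (cong-app (^ᵒ-sucʳ A k v) r)))

I+·^ᵒ-frobenius : ∀ {p} → Prime p → ∀ b {A} → IsLinear A → ∀ v r →
  ((I+ b · A) ^ᵒ p) v r ≡ (I+ b ^ p · (A ^ᵒ p)) v r ⟨mod + p ⟩
I+·^ᵒ-frobenius {0}            (prime {{()}} _)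
I+·^ᵒ-frobenius {1}            (prime {{()}} _)
I+·^ᵒ-frobenius {P@(suc (suc p))} P-prime b {A} A-linear v r =
  mk≡mod (subst (+ P ∣_) (sym difference) (sumTo-∣ p (λ k → f (suc k)) P∣middle))
  where
  open ≡-Reasoning
  f : ℕ → ℤ
  f k = + (P C k) * (b ^ k * (A ^ᵒ k) v r)
  M = sumTo p (λ k → f (suc k))
  P∣middle : ∀ k → k ≤ p → + P ∣ f (suc k)
  P∣middle k k≤p = ∣m⇒∣m*n (b ^ suc k * (A ^ᵒ suc k) v r)
                           (∣ᵤ⇒∣ {+ P} {+ (P C suc k)} (p∣pCk P-prime (s≤s z≤n) (s≤s (s≤s k≤p))))
  cancel : ∀ x M y → (1ℤ * (1ℤ * x) + M + 1ℤ * y) - (x + y) ≡ M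
  cancel = solve-∀
  difference : ((I+ b · A) ^ᵒ P) v r - (I+ b ^ P · (A ^ᵒ P)) v r ≡ M
  difference = begin
    ((I+ b · A) ^ᵒ P) v r - (v r + b ^ P * (A ^ᵒ P) v r)
      ≡⟨ cong (_- (v r + b ^ P * (A ^ᵒ P) v r)) (I+·^ᵒ-binomial b A-linear P v r) ⟩
    sumTo (suc p) f + f P - (v r + b ^ P * (A ^ᵒ P) v r)
      ≡⟨ cong₂ (λ s c → s + + c * (b ^ P * (A ^ᵒ P) v r) - (v r + b ^ P * (A ^ᵒ P) v r))
               (sumTo-suc p f) (nCn≡1 P) ⟩
    (1ℤ * (1ℤ * v r) + M + 1ℤ * (b ^ P * (A ^ᵒ P) v r)) - (v r + b ^ P * (A ^ᵒ P) v r)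
      ≡⟨ cancel (v r) M (b ^ P * (A ^ᵒ P) v r) ⟩
    M ∎

^ᵒ-≡mod : ∀ {d A B} → IsLinear B → (∀ v x → A v x ≡ B v x ⟨mod d ⟩) →
          ∀ N v x → (A ^ᵒ N) v x ≡ (B ^ᵒ N) v x ⟨mod d ⟩
^ᵒ-≡mod B-linear A≡B zero    v x = ≡⇒≡mod refl
^ᵒ-≡mod {d} {A} {B} B-linear A≡B (suc N) v x =
  ≡mod-trans (A≡B ((A ^ᵒ N) v) x)
             (linear-≡mod B-linear {d} {(A ^ᵒ N) v} {(B ^ᵒ N) v} (^ᵒ-≡mod B-linear A≡B N v) x)

ℤ-induction : ∀ {ℓ} {P : ℤ → Set ℓ} → P 0ℤ →
  (∀ x → P x → P (1ℤ + x)) → (∀ x → P (1ℤ + x) → P x) → ∀ x → P x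
ℤ-induction {P = P} P0 up down = go
  where
  go : ∀ x → P x
  go (+ zero)           = P0
  go (+ suc n)          = up (+ n) (go (+ n))
  go ℤ.-[1+ zero ]      = down ℤ.-[1+ zero ] P0
  go ℤ.-[1+ suc n ]     = down ℤ.-[1+ suc n ] (go ℤ.-[1+ n ])

module _ {p} (p-prime : Prime p) where

  freshman's-dream : ∀ x → (1ℤ + x) ^ p ≡ 1ℤ + x ^ p ⟨mod + p ⟩
  freshman's-dream x = subst₂ (λ s t → s ≡ t ⟨mod + p ⟩)
    (trans (^ᵒ-eigen (I+·-linear x id-linear) (1ℤ + x) (λ _ → one-step x) p 0ℤ)
           (ℤP.*-identityʳ ((1ℤ + x) ^ p)))
    (trans (cong (λ t → 1ℤ + x ^ p * t) (cong-app (id-^ᵒ p (λ _ → 1ℤ)) 0ℤ))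
           (cong (λ t → 1ℤ + t) (ℤP.*-identityʳ (x ^ p))))
    (I+·^ᵒ-frobenius p-prime x id-linear (λ _ → 1ℤ) 0ℤ)
    where
    one-step : ∀ x → 1ℤ + x * 1ℤ ≡ (1ℤ + x) * 1ℤ
    one-step = solve-∀

  fermat : ∀ x → x ^ p ≡ x ⟨mod + p ⟩
  fermat = ℤ-induction zero^p up down
    where
    0^[1+n]≡0 : ∀ n → .{{ℕ.NonZero n}} → 0ℤ ^ n ≡ 0ℤ
    0^[1+n]≡0 (suc n) = refl
    zero^p : 0ℤ ^ p ≡ 0ℤ ⟨mod + p ⟩
    zero^p = ≡⇒≡mod (0^[1+n]≡0 p {{prime⇒nonZero p-prime}})
    up : ∀ x → x ^ p ≡ x ⟨mod + p ⟩ → (1ℤ + x) ^ p ≡ 1ℤ + x ⟨mod + p ⟩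
    up x x^p≡x = ≡mod-trans (freshman's-dream x) (≡mod-+ (≡⇒≡mod {1ℤ} refl) x^p≡x)
    down : ∀ x → (1ℤ + x) ^ p ≡ 1ℤ + x ⟨mod + p ⟩ → x ^ p ≡ x ⟨mod + p ⟩
    down x [1+x]^p≡1+x = ≡mod-cancel-+ˡ 1ℤ (≡mod-trans (≡mod-sym (freshman's-dream x)) [1+x]^p≡1+x)

  fermat-^ : ∀ j x → x ^ (p ℕ.^ j) ≡ x ⟨mod + p ⟩
  fermat-^ zero    x = ≡⇒≡mod (ℤP.^-identityʳ x)
  fermat-^ (suc j) x = ≡mod-trans (≡⇒≡mod (sym x^[p^j]^p)) (≡mod-trans (fermat (x ^ (p ℕ.^ j))) (fermat-^ j x))
    where
    x^[p^j]^p : (x ^ (p ℕ.^ j)) ^ p ≡ x ^ (p ℕ.^ suc j)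
    x^[p^j]^p = trans (ℤP.^-*-assoc x (p ℕ.^ j) p) (cong (x ^_) (ℕP.*-comm (p ℕ.^ j) p))

-- Periodic sequences with zero mean

module _ (m : ℕ) where

  Periodic : Seq → Set
  Periodic v = ∀ r → v (r + + m) ≡ v r

  window : Seq → Seq
  window v r = sumBelow m (λ j → v (r - + j))

  record MeanZero (v : Seq) : Set where
    field
      periodic : Periodic v
      window≡0 : ∀ r → window v r ≡ 0ℤ

  open MeanZero public

  periodic-multiple : ∀ {v} → Periodic v → ∀ k r → v (r + + (k ℕ.* m)) ≡ v r
  periodic-multiple {v} v-periodic zero    r = cong v (ℤP.+-identityʳ r)
  periodic-multiple {v} v-periodic (suc k) r = begin
    v (r + + (m ℕ.+ k ℕ.* m))     ≡⟨ cong v (step r (+ m) (+ (k ℕ.* m))) ⟩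
    v (r + + (k ℕ.* m) + + m)     ≡⟨ v-periodic (r + + (k ℕ.* m)) ⟩
    v (r + + (k ℕ.* m))           ≡⟨ periodic-multiple v-periodic k r ⟩
    v r                           ∎
    where
    open ≡-Reasoning
    step : ∀ r m km → r + (m + km) ≡ r + km + m
    step = solve-∀

  periodic⁻ : ∀ {v} → Periodic v → ∀ r → v (r - + m) ≡ v r
  periodic⁻ {v} v-periodic r = trans (sym (v-periodic (r - + m))) (cong v (restore r (+ m)))
    where
    restore : ∀ r m → r - m + m ≡ r
    restore = solve-∀

  window-suc : ∀ {v} → Periodic v → ∀ r → window v (1ℤ + r) ≡ window v r
  window-suc {v} v-periodic r = begin
    window v (1ℤ + r)                              ≡⟨ sumBelow-slide m v r ⟩
    v (1ℤ + r) - v (1ℤ + r - + m) + window v r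
      ≡⟨ cong (λ t → v (1ℤ + r) - t + window v r) (periodic⁻ v-periodic (1ℤ + r)) ⟩
    v (1ℤ + r) - v (1ℤ + r) + window v r           ≡⟨ cong (_+ window v r) (ℤP.+-inverseʳ (v (1ℤ + r))) ⟩
    0ℤ + window v r                                ≡⟨ ℤP.+-identityˡ (window v r) ⟩
    window v r                                     ∎
    where open ≡-Reasoning

  meanZero-cong : ∀ {v w} → (∀ x → v x ≡ w x) → MeanZero v → MeanZero w
  meanZero-cong {v} {w} v≗w v-mz = record
    { periodic = λ r → trans (sym (v≗w (r + + m))) (trans (periodic v-mz r) (v≗w r))
    ; window≡0 = λ r → trans (sumBelow-cong m (λ j → sym (v≗w (r - + j)))) (window≡0 v-mz r)
    }

  meanZero-linear : ∀ c d {v w} → MeanZero v → MeanZero w → MeanZero (λ x → c * v x + d * w x)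
  meanZero-linear c d {v} {w} v-mz w-mz = record
    { periodic = λ r → cong₂ (λ s t → c * s + d * t) (periodic v-mz r) (periodic w-mz r)
    ; window≡0 = λ r → begin
        sumBelow m (λ j → c * v (r - + j) + d * w (r - + j))
          ≡⟨ sumBelow-distrib-+ m _ _ ⟩
        sumBelow m (λ j → c * v (r - + j)) + sumBelow m (λ j → d * w (r - + j))
          ≡⟨ cong₂ _+_ (*-distribˡ-sumBelow m c _) (*-distribˡ-sumBelow m d _) ⟨
        c * window v r + d * window w r
          ≡⟨ cong₂ (λ s t → c * s + d * t) (window≡0 v-mz r) (window≡0 w-mz r) ⟩
        c * 0ℤ + d * 0ℤ
          ≡⟨ annihilate c d ⟩
        0ℤ ∎
    }
    where
    open ≡-Reasoning
    annihilate : ∀ c d → c * 0ℤ + d * 0ℤ ≡ 0ℤ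
    annihilate = solve-∀

  meanZero-shift : ∀ {v} → MeanZero v → MeanZero (shift v)
  meanZero-shift {v} v-mz = record
    { periodic = λ r → trans (cong v (swap r (+ m) 1ℤ)) (periodic v-mz (r - 1ℤ))
    ; window≡0 = λ r → trans (sumBelow-cong m (λ j → cong v (swap r (- + j) (1ℤ))))
                              (window≡0 v-mz (r - 1ℤ))
    }
    where
    swap : ∀ r s t → r + s - t ≡ r - t + s
    swap = solve-∀

  meanZero-divide : ∀ (d : ℤ) .{{_ : ℤ.NonZero d}} {w z} → (∀ x → w x ≡ d * z x) →
                    MeanZero w → MeanZero z
  meanZero-divide d {w} {z} w≡dz w-mz = record
    { periodic = λ r → ℤP.*-cancelˡ-≡ d (z (r + + m)) (z r)
                         (trans (sym (w≡dz (r + + m))) (trans (periodic w-mz r) (w≡dz r)))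
    ; window≡0 = λ r → ℤP.*-cancelˡ-≡ d (window z r) 0ℤ (begin
        d * window z r                     ≡⟨ *-distribˡ-sumBelow m d _ ⟩
        sumBelow m (λ j → d * z (r - + j))  ≡⟨ sumBelow-cong m (λ j → sym (w≡dz (r - + j))) ⟩
        window w r                         ≡⟨ window≡0 w-mz r ⟩
        0ℤ                                 ≡⟨ ℤP.*-zeroʳ d ⟨
        d * 0ℤ                             ∎)
    }
    where open ≡-Reasoning

  δ : Seq
  δ x = if ⌊ m ℕD.∣? ℤ.∣ x ∣ ⌋ then 1ℤ else 0ℤ

  δ≡1 : ∀ {x} → m ℕD.∣ ℤ.∣ x ∣ → δ x ≡ 1ℤ
  δ≡1 {x} m∣x with m ℕD.∣? ℤ.∣ x ∣
  ... | yes _   = refl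
  ... | no  m∤x = contradiction m∣x m∤x

  δ≡0 : ∀ {x} → ¬ (m ℕD.∣ ℤ.∣ x ∣) → δ x ≡ 0ℤ
  δ≡0 {x} m∤x with m ℕD.∣? ℤ.∣ x ∣
  ... | yes m∣x = contradiction m∣x m∤x
  ... | no  _   = refl

  δ-cong : ∀ {x y} → + m ∣ x - y → δ x ≡ δ y
  δ-cong {x} {y} m∣x-y with m ℕD.∣? ℤ.∣ x ∣ | m ℕD.∣? ℤ.∣ y ∣
  ... | yes _   | yes _   = refl
  ... | no  _   | no  _   = refl
  ... | yes m∣x | no  m∤y =
    contradiction (∣⇒∣ᵤ (subst (+ m ∣_) (cancel x y) (∣m∣n⇒∣m-n (∣ᵤ⇒∣ {+ m} {x} m∣x) m∣x-y))) m∤y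
    where
    cancel : ∀ x y → x - (x - y) ≡ y
    cancel = solve-∀
  ... | no  m∤x | yes m∣y =
    contradiction (∣⇒∣ᵤ (subst (+ m ∣_) (restore x y) (∣m∣n⇒∣m+n m∣x-y (∣ᵤ⇒∣ {+ m} {y} m∣y)))) m∤x
    where
    restore : ∀ x y → x - y + y ≡ x
    restore = solve-∀

  δ-periodic : Periodic δ
  δ-periodic x = δ-cong {x + + m} {x} (divides 1ℤ (cancel x (+ m)))
    where
    cancel : ∀ x m → x + m - x ≡ 1ℤ * m
    cancel = solve-∀

  v₀ : Seq
  v₀ x = + m * δ x - 1ℤ

window-δ : ∀ M r → window (suc M) (δ (suc M)) r ≡ 1ℤ
window-δ M = ℤ-induction window-δ[0]
  (λ r window≡1 → trans (window-suc (suc M) (δ-periodic (suc M)) r) window≡1)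
  (λ r window≡1 → trans (sym (window-suc (suc M) (δ-periodic (suc M)) r)) window≡1)
  where
  window-δ[0] : window (suc M) (δ (suc M)) 0ℤ ≡ 1ℤ
  window-δ[0] = begin
    sumBelow (suc M) (λ j → δ (suc M) (0ℤ - + j))
      ≡⟨ sumBelow-suc M _ ⟩
    δ (suc M) 0ℤ + sumBelow M (λ j → δ (suc M) (0ℤ - + suc j))
      ≡⟨ cong₂ _+_ (δ≡1 (suc M) {0ℤ} (suc M ℕD.∣0))
                   (sumBelow-zero M (λ j j<M → δ≡0 (suc M) {0ℤ - + suc j}
                                                    (λ m∣1+j → ℕP.<⇒≱ (s≤s j<M) (ℕD.∣⇒≤ m∣1+j)))) ⟩
    1ℤ + 0ℤ
      ≡⟨⟩
    1ℤ ∎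
    where open ≡-Reasoning

meanZero-v₀ : ∀ M → MeanZero (suc M) (v₀ (suc M))
meanZero-v₀ M = record
  { periodic = λ x → cong (λ t → + m * t - 1ℤ) (δ-periodic m x)
  ; window≡0 = λ r → begin
      sumBelow m (λ j → + m * δ m (r - + j) + - 1ℤ)
        ≡⟨ sumBelow-distrib-+ m _ _ ⟩
      sumBelow m (λ j → + m * δ m (r - + j)) + sumBelow m (λ _ → - 1ℤ)
        ≡⟨ cong₂ _+_ (*-distribˡ-sumBelow m (+ m) _) (sym (sumBelow-const m (- 1ℤ))) ⟨
      + m * window m (δ m) r + + m * - 1ℤ
        ≡⟨ cong (λ t → + m * t + + m * - 1ℤ) (window-δ M r) ⟩
      + m * 1ℤ + + m * - 1ℤ
        ≡⟨ cancel (+ m) ⟩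
      0ℤ ∎
  }
  where
  open ≡-Reasoning
  m = suc M
  cancel : ∀ m → m * 1ℤ + m * - 1ℤ ≡ 0ℤ
  cancel = solve-∀

-- Convolutions inverting U

convolve : ℕ → (ℕ → ℤ) → Endo
convolve M κ v r = sumBelow M (λ j → κ j * v (r - + j))

periodic-convolve : ∀ {m} M κ {v} → Periodic m v → Periodic m (convolve M κ v)
periodic-convolve {m} M κ {v} v-periodic r =
  sumBelow-cong M (λ j → cong (κ j *_) (trans (cong v (swap r (+ m) (+ j))) (v-periodic (r - + j))))
  where
  swap : ∀ r m j → r + m - j ≡ r - j + m
  swap = solve-∀

r-1-M≡r-[1+M] : ∀ r M → r - 1ℤ - + M ≡ r - + suc M
r-1-M≡r-[1+M] r M = reassoc r (+ M)
  where
  reassoc : ∀ r M → r - 1ℤ - M ≡ r - (1ℤ + M)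
  reassoc = solve-∀

convolve-geometric : ∀ a M v r →
  convolve M (λ j → (- a) ^ j) v r + a * convolve M (λ j → (- a) ^ j) v (r - 1ℤ)
    ≡ v r - (- a) ^ M * v (r - + M)
convolve-geometric a zero    v r = begin
  0ℤ + a * 0ℤ          ≡⟨ vanish a ⟩
  0ℤ                   ≡⟨ ℤP.+-inverseʳ (v r) ⟨
  v r - v r            ≡⟨ cong (λ t → v r - t) (trans (ℤP.*-identityˡ (v (r - + 0))) (cong v (ℤP.+-identityʳ r))) ⟨
  v r - 1ℤ * v (r - + 0) ∎
  where
  open ≡-Reasoning
  vanish : ∀ a → 0ℤ + a * 0ℤ ≡ 0ℤ
  vanish = solve-∀
convolve-geometric a (suc M) v r = begin
  (G r + X * v (r - + M)) + a * (G (r - 1ℤ) + X * v (r - 1ℤ - + M))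
    ≡⟨ regroup (G r) (G (r - 1ℤ)) X (v (r - + M)) (v (r - 1ℤ - + M)) a ⟩
  (G r + a * G (r - 1ℤ)) + X * v (r - + M) + a * X * v (r - 1ℤ - + M)
    ≡⟨ cong₂ (λ s t → s + X * v (r - + M) + a * X * v t) (convolve-geometric a M v r) (r-1-M≡r-[1+M] r M) ⟩
  v r - X * v (r - + M) + X * v (r - + M) + a * X * v (r - + suc M)
    ≡⟨ collapse (v r) X (v (r - + M)) (v (r - + suc M)) a ⟩
  v r - (- a) ^ suc M * v (r - + suc M) ∎
  where
  open ≡-Reasoning
  G = convolve M (λ j → (- a) ^ j) v
  X = (- a) ^ M
  regroup : ∀ A B X V W a → (A + X * V) + a * (B + X * W) ≡ (A + a * B) + X * V + a * X * W
  regroup = solve-∀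
  collapse : ∀ R X V W a → R - X * V + X * V + a * X * W ≡ R - (- a) * X * W
  collapse = solve-∀

geometric-sum : ∀ a M → (1ℤ + a) * sumBelow M (λ j → (- a) ^ j) ≡ 1ℤ - (- a) ^ M
geometric-sum a zero    = ℤP.*-zeroʳ (1ℤ + a)
geometric-sum a (suc M) = begin
  (1ℤ + a) * (S + (- a) ^ M)             ≡⟨ ℤP.*-distribˡ-+ (1ℤ + a) S ((- a) ^ M) ⟩
  (1ℤ + a) * S + (1ℤ + a) * (- a) ^ M    ≡⟨ cong (_+ (1ℤ + a) * (- a) ^ M) (geometric-sum a M) ⟩
  1ℤ - (- a) ^ M + (1ℤ + a) * (- a) ^ M  ≡⟨ collapse a ((- a) ^ M) ⟩
  1ℤ - (- a) * (- a) ^ M                 ∎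
  where
  open ≡-Reasoning
  S = sumBelow M (λ j → (- a) ^ j)
  collapse : ∀ a X → 1ℤ - X + (1ℤ + a) * X ≡ 1ℤ - (- a) * X
  collapse = solve-∀

convolve-ramp : ∀ M v r →
  convolve M (λ j → + suc j) v r - convolve M (λ j → + suc j) v (r - 1ℤ)
    ≡ sumBelow M (λ j → v (r - + j)) - + M * v (r - + M)
convolve-ramp zero    v r = refl
convolve-ramp (suc M) v r = begin
  (H r + + suc M * v (r - + M)) - (H (r - 1ℤ) + + suc M * v (r - 1ℤ - + M))
    ≡⟨ cong (λ t → (H r + + suc M * v (r - + M)) - (H (r - 1ℤ) + + suc M * v t)) (r-1-M≡r-[1+M] r M) ⟩
  (H r + + suc M * v (r - + M)) - (H (r - 1ℤ) + + suc M * v (r - + suc M))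
    ≡⟨ regroup (H r) (H (r - 1ℤ)) (+ M) (v (r - + M)) (v (r - + suc M)) ⟩
  (H r - H (r - 1ℤ)) + (1ℤ + + M) * v (r - + M) - (1ℤ + + M) * v (r - + suc M)
    ≡⟨ cong (λ t → t + (1ℤ + + M) * v (r - + M) - (1ℤ + + M) * v (r - + suc M)) (convolve-ramp M v r) ⟩
  W - + M * v (r - + M) + (1ℤ + + M) * v (r - + M) - (1ℤ + + M) * v (r - + suc M)
    ≡⟨ collapse W (+ M) (v (r - + M)) (v (r - + suc M)) ⟩
  (W + v (r - + M)) - (1ℤ + + M) * v (r - + suc M) ∎
  where
  open ≡-Reasoning
  H = convolve M (λ j → + suc j) v
  W = sumBelow M (λ j → v (r - + j))
  regroup : ∀ A B M V V′ → (A + (1ℤ + M) * V) - (B + (1ℤ + M) * V′) ≡ (A - B) + (1ℤ + M) * V - (1ℤ + M) * V′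
  regroup = solve-∀
  collapse : ∀ W M V V′ → W - M * V + (1ℤ + M) * V - (1ℤ + M) * V′ ≡ (W + V) - (1ℤ + M) * V′
  collapse = solve-∀

-- The operator U = 1 + a S

module _ (m : ℕ) (a : ℤ) where

  U : Endo
  U = I+ a · shift

  U-linear : IsLinear U
  U-linear = I+·-linear a shift-linear

  U^-linear : ∀ N → IsLinear (U ^ᵒ N)
  U^-linear = ^ᵒ-linear U-linear

  meanZero-U^ : ∀ N {v} → MeanZero m v → MeanZero m ((U ^ᵒ N) v)
  meanZero-U^ zero    v-mz = v-mz
  meanZero-U^ (suc N) {v} v-mz =
    meanZero-cong m (λ x → cong (_+ a * (U ^ᵒ N) v (x - 1ℤ)) (ℤP.*-identityˡ ((U ^ᵒ N) v x)))
    (meanZero-linear m 1ℤ a (meanZero-U^ N v-mz) (meanZero-shift m (meanZero-U^ N v-mz)))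

  infix 4 U^_≡1[mod_]
  U^_≡1[mod_] : ℕ → ℤ → Set
  U^ K ≡1[mod d ] = ∀ {v} → MeanZero m v → ∀ r → (U ^ᵒ K) v r ≡ v r ⟨mod d ⟩

  U^≡1-quotient : ∀ {K} d .{{_ : ℤ.NonZero d}} → U^ K ≡1[mod d ] → ∀ {v} → MeanZero m v →
    Σ Seq λ z → MeanZero m z × (∀ x → (U ^ᵒ K) v x ≡ 1ℤ * v x + d * z x)
  U^≡1-quotient {K} d U^K≡1 {v} v-mz = z , z-mz , λ x → ≡mod-decompose (U^K≡1 v-mz x)
    where
    z : Seq
    z x = ≡mod-quotient (U^K≡1 v-mz x)
    difference : ∀ x → (U ^ᵒ K) v x - v x ≡ d * z x
    difference x = trans (_∣_.equality (∣-difference (U^K≡1 v-mz x))) (ℤP.*-comm (z x) d)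
    as-difference : ∀ a b → 1ℤ * a + (- 1ℤ) * b ≡ a - b
    as-difference = solve-∀
    z-mz : MeanZero m z
    z-mz = meanZero-divide m d difference
      (meanZero-cong m (λ x → as-difference ((U ^ᵒ K) v x) (v x))
        (meanZero-linear m 1ℤ (- 1ℤ) (meanZero-U^ K v-mz) v-mz))

  U^≡1-* : ∀ {K d} → U^ K ≡1[mod d ] → ∀ c → U^ (c ℕ.* K) ≡1[mod d ]
  U^≡1-* U^K≡1 zero    v-mz r = ≡⇒≡mod refl
  U^≡1-* {K} U^K≡1 (suc c) {v} v-mz r = ≡mod-trans
    (≡mod-trans (≡⇒≡mod (cong-app (^ᵒ-+ U K (c ℕ.* K) v) r)) (U^K≡1 (meanZero-U^ (c ℕ.* K) v-mz) r))
    (U^≡1-* {K} U^K≡1 c v-mz r)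

  -- With U^K v = v + d z: U^(pK) v - v = d Σ_{i<p} U^(iK) z, and U^(iK) z ≡ z (mod p).
  U^≡1-lift : ∀ {p K} d .{{_ : ℤ.NonZero d}} → + p ∣ d → U^ K ≡1[mod d ] → U^ (p ℕ.* K) ≡1[mod d * + p ]
  U^≡1-lift {p} {K} d p∣d U^K≡1 {v} v-mz r =
    mk≡mod (subst (d * + p ∣_) (sym telescoped) (*-monoʳ-∣ d p∣sum))
    where
    open ≡-Reasoning
    quotient = U^≡1-quotient {K} d U^K≡1 v-mz
    z = proj₁ quotient
    f : ℕ → ℤ
    f i = (U ^ᵒ (i ℕ.* K)) v r
    y : ℕ → ℤ
    y i = (U ^ᵒ (i ℕ.* K)) z r
    cancel : ∀ a b d → 1ℤ * a + d * b - a ≡ d * b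
    cancel = solve-∀
    step : ∀ i → f (suc i) - f i ≡ d * y i
    step i = begin
      (U ^ᵒ (K ℕ.+ i ℕ.* K)) v r - f i
        ≡⟨ cong (λ n → (U ^ᵒ n) v r - f i) (ℕP.+-comm K (i ℕ.* K)) ⟩
      (U ^ᵒ (i ℕ.* K ℕ.+ K)) v r - f i
        ≡⟨ cong (_- f i) (cong-app (^ᵒ-+ U (i ℕ.* K) K v) r) ⟩
      (U ^ᵒ (i ℕ.* K)) ((U ^ᵒ K) v) r - f i
        ≡⟨ cong (_- f i) (U^-linear (i ℕ.* K) 1ℤ d (proj₂ (proj₂ quotient)) r) ⟩
      1ℤ * f i + d * y i - f i
        ≡⟨ cancel (f i) (y i) d ⟩
      d * y i ∎
    telescoped : (U ^ᵒ (p ℕ.* K)) v r - v r ≡ d * sumBelow p y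
    telescoped = begin
      f p - f 0                         ≡⟨ sumBelow-telescope p f ⟨
      sumBelow p (λ i → f (suc i) - f i) ≡⟨ sumBelow-cong p step ⟩
      sumBelow p (λ i → d * y i)         ≡⟨ *-distribˡ-sumBelow p d y ⟨
      d * sumBelow p y                   ∎
    p∣sum : + p ∣ sumBelow p y
    p∣sum = ≡mod-∣
      (≡mod-trans (sumBelow-≡mod p (λ i → ≡mod-weaken p∣d (U^≡1-* {K} U^K≡1 i (proj₁ (proj₂ quotient)) r)))
                  (≡⇒≡mod (sumBelow-const p (z r))))
      (∣m⇒∣m*n (z r) (divides 1ℤ (sym (ℤP.*-identityˡ (+ p)))))

  q^n∣[I-U^T]^n : ∀ {T} q .{{_ : ℕ.NonZero q}} → U^ T ≡1[mod + q ] →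
              ∀ n {v} → MeanZero m v → ∀ r → + (q ℕ.^ n) ∣ ((I+ - 1ℤ · (U ^ᵒ T)) ^ᵒ n) v r
  q^n∣[I-U^T]^n q U^T≡1 zero    {v} v-mz r = divides (v r) (sym (ℤP.*-identityʳ (v r)))
  q^n∣[I-U^T]^n {T} q U^T≡1 (suc n) {v} v-mz r =
    subst₂ _∣_ (sym (ℤP.pos-* q (q ℕ.^ n))) (sym Dⁿ⁺¹v≡-qDⁿz)
           (∣m⇒∣-m (*-monoʳ-∣ (+ q) (q^n∣[I-U^T]^n {T} q U^T≡1 n (proj₁ (proj₂ quotient)) r)))
    where
    open ≡-Reasoning
    D = I+ - 1ℤ · (U ^ᵒ T)
    quotient = U^≡1-quotient {T} (+ q) U^T≡1 v-mz
    z = proj₁ quotient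
    collapse : ∀ v q z → v + - 1ℤ * (1ℤ * v + q * z) ≡ - q * z
    collapse = solve-∀
    Dv≡-qz : ∀ x → D v x ≡ - + q * z x
    Dv≡-qz x = trans (cong (λ t → v x + - 1ℤ * t) (proj₂ (proj₂ quotient) x)) (collapse (v x) (+ q) (z x))
    Dⁿ⁺¹v≡-qDⁿz : (D ^ᵒ suc n) v r ≡ - (+ q * (D ^ᵒ n) z r)
    Dⁿ⁺¹v≡-qDⁿz = begin
      (D ^ᵒ suc n) v r        ≡⟨ cong-app (^ᵒ-sucʳ D n v) r ⟩
      (D ^ᵒ n) (D v) r        ≡⟨ linear-scale (^ᵒ-linear (I+·-linear (- 1ℤ) (U^-linear T)) n) (- + q) Dv≡-qz r ⟩
      - + q * (D ^ᵒ n) z r    ≡⟨ ℤP.neg-distribˡ-* (+ q) _ ⟨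
      - (+ q * (D ^ᵒ n) z r)  ∎

  S : ℤ
  S = sumBelow m (λ j → (- a) ^ j)

  U-convolve-geometric : ∀ {v} → Periodic m v → ∀ r →
    U (convolve m (λ j → (- a) ^ j) v) r ≡ (1ℤ + a) * S * v r
  U-convolve-geometric {v} v-periodic r = begin
    U (convolve m (λ j → (- a) ^ j) v) r   ≡⟨ convolve-geometric a m v r ⟩
    v r - (- a) ^ m * v (r - + m)          ≡⟨ cong (λ t → v r - (- a) ^ m * t) (periodic⁻ m v-periodic r) ⟩
    v r - (- a) ^ m * v r                  ≡⟨ factor (v r) ((- a) ^ m) ⟩
    (1ℤ - (- a) ^ m) * v r                 ≡⟨ cong (_* v r) (geometric-sum a m) ⟨
    (1ℤ + a) * S * v r                     ∎
    where
    open ≡-Reasoning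
    factor : ∀ v X → v - X * v ≡ (1ℤ - X) * v
    factor = solve-∀

  U-convolve-ramp : ∀ {v} → MeanZero m v → ∀ r →
    U (convolve m (λ j → + suc j) v) r ≡ - + m * v r + (1ℤ + a) * convolve m (λ j → + suc j) v (r - 1ℤ)
  U-convolve-ramp {v} v-mz r = begin
    H r + a * H (r - 1ℤ)
      ≡⟨ regroup (H r) (H (r - 1ℤ)) a ⟩
    (H r - H (r - 1ℤ)) + (1ℤ + a) * H (r - 1ℤ)
      ≡⟨ cong (_+ (1ℤ + a) * H (r - 1ℤ)) (convolve-ramp m v r) ⟩
    window m v r - + m * v (r - + m) + (1ℤ + a) * H (r - 1ℤ)
      ≡⟨ cong₂ (λ s t → s - + m * t + (1ℤ + a) * H (r - 1ℤ)) (window≡0 v-mz r) (periodic⁻ m (periodic v-mz) r) ⟩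
    0ℤ - + m * v r + (1ℤ + a) * H (r - 1ℤ)
      ≡⟨ cong (_+ (1ℤ + a) * H (r - 1ℤ)) (negate (+ m * v r)) ⟩
    - (+ m * v r) + (1ℤ + a) * H (r - 1ℤ)
      ≡⟨ cong (_+ (1ℤ + a) * H (r - 1ℤ)) (ℤP.neg-distribˡ-* (+ m) (v r)) ⟩
    - + m * v r + (1ℤ + a) * H (r - 1ℤ) ∎
    where
    open ≡-Reasoning
    H = convolve m (λ j → + suc j) v
    regroup : ∀ h h′ a → h + a * h′ ≡ (h - h′) + (1ℤ + a) * h′
    regroup = solve-∀
    negate : ∀ x → 0ℤ - x ≡ - x
    negate = solve-∀

  module _ {p} (p-prime : Prime p) (p∤m : ¬ (+ p ∣ + m)) (p∤S : ¬ (+ p ∣ S))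
           {β k} (p^β≡1+km : p ℕ.^ β ≡ suc (k ℕ.* m)) where

    U^[p^j]≡I+a^[p^j]·shift^[p^j] : ∀ j v r →
      (U ^ᵒ (p ℕ.^ j)) v r ≡ (I+ a ^ (p ℕ.^ j) · (shift ^ᵒ (p ℕ.^ j))) v r ⟨mod + p ⟩
    U^[p^j]≡I+a^[p^j]·shift^[p^j] zero    v r =
      ≡⇒≡mod (cong (λ t → v r + t * v (r - 1ℤ)) (sym (ℤP.^-identityʳ a)))
    U^[p^j]≡I+a^[p^j]·shift^[p^j] (suc j) v r = ≡mod-trans
      (subst (λ f → f v r ≡ (B ^ᵒ p) v r ⟨mod + p ⟩) (^ᵒ-* U p (p ℕ.^ j))
        (^ᵒ-≡mod (I+·-linear b (^ᵒ-linear shift-linear (p ℕ.^ j))) (U^[p^j]≡I+a^[p^j]·shift^[p^j] j) p v r))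
      (subst₂ (λ c A → (B ^ᵒ p) v r ≡ (I+ c · A) v r ⟨mod + p ⟩)
        (trans (ℤP.^-*-assoc a (p ℕ.^ j) p) (cong (a ^_) (ℕP.*-comm (p ℕ.^ j) p)))
        (^ᵒ-* shift p (p ℕ.^ j))
        (I+·^ᵒ-frobenius p-prime b (^ᵒ-linear shift-linear (p ℕ.^ j)) v r))
      where
      b = a ^ (p ℕ.^ j)
      B = I+ b · (shift ^ᵒ (p ℕ.^ j))

    U^[p^β]≡U : ∀ {v} → Periodic m v → ∀ r → (U ^ᵒ (p ℕ.^ β)) v r ≡ U v r ⟨mod + p ⟩
    U^[p^β]≡U {v} v-periodic r = ≡mod-trans (U^[p^j]≡I+a^[p^j]·shift^[p^j] β v r)
      (≡mod-+ (≡⇒≡mod {v r} refl)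
        (subst (λ t → a ^ (p ℕ.^ β) * t ≡ a * v (r - 1ℤ) ⟨mod + p ⟩) (sym shifted)
               (≡mod-*ʳ (v (r - 1ℤ)) (fermat-^ p-prime β a))))
      where
      back : ∀ r km → r - (1ℤ + km) + km ≡ r - 1ℤ
      back = solve-∀
      shifted : (shift ^ᵒ (p ℕ.^ β)) v r ≡ v (r - 1ℤ)
      shifted = begin
        (shift ^ᵒ (p ℕ.^ β)) v r      ≡⟨ shift-^ᵒ (p ℕ.^ β) v r ⟩
        v (r - + (p ℕ.^ β))           ≡⟨ cong (λ n → v (r - + n)) p^β≡1+km ⟩
        v (r - + suc (k ℕ.* m))       ≡⟨ periodic-multiple m v-periodic k _ ⟨
        v (r - + suc (k ℕ.* m) + + (k ℕ.* m)) ≡⟨ cong v (back r (+ (k ℕ.* m))) ⟩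
        v (r - 1ℤ)                    ∎
        where open ≡-Reasoning

    U^km≡1-on-image : ∀ {c v w} → ¬ (+ p ∣ c) → Periodic m w → (∀ x → U w x ≡ c * v x ⟨mod + p ⟩) →
                 ∀ r → (U ^ᵒ (k ℕ.* m)) v r ≡ v r ⟨mod + p ⟩
    U^km≡1-on-image {c} {v} {w} p∤c w-periodic Uw≡cv r = ≡mod-cancelˡ p-prime p∤c (begin
      c * (U ^ᵒ (k ℕ.* m)) v r            ≡⟨ linear-scale (U^-linear (k ℕ.* m)) c (λ _ → refl) r ⟨
      (U ^ᵒ (k ℕ.* m)) (λ x → c * v x) r  ≈⟨ linear-≡mod (U^-linear (k ℕ.* m)) (λ x → ≡mod-sym (Uw≡cv x)) r ⟩
      (U ^ᵒ (k ℕ.* m)) (U w) r            ≡⟨ cong-app (^ᵒ-sucʳ U (k ℕ.* m) w) r ⟨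
      (U ^ᵒ suc (k ℕ.* m)) w r            ≡⟨ cong (λ n → (U ^ᵒ n) w r) p^β≡1+km ⟨
      (U ^ᵒ (p ℕ.^ β)) w r                ≈⟨ U^[p^β]≡U w-periodic r ⟩
      U w r                               ≈⟨ Uw≡cv r ⟩
      c * v r                             ∎)
      where open ≡mod-Reasoning (+ p)

    -- The preimage w is the geometric convolution of v when p ∤ 1 + a, and the ramp
    -- convolution when p ∣ 1 + a (then U ≡ 1 - S modulo p).
    U^km≡1 : U^ (k ℕ.* m) ≡1[mod + p ]
    U^km≡1 {v} v-mz r with + p ∣? 1ℤ + a
    ... | no p∤1+a = U^km≡1-on-image (λ p∣[1+a]S → p∤S (p∣c*z∧p∤c⇒p∣z p-prime p∤1+a p∣[1+a]S))
          (periodic-convolve m (λ j → (- a) ^ j) (periodic v-mz))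
          (λ x → ≡⇒≡mod (U-convolve-geometric (periodic v-mz) x)) r
    ... | yes p∣1+a = U^km≡1-on-image (λ p∣-m → p∤m (subst (+ p ∣_) (ℤP.neg-involutive (+ m)) (∣m⇒∣-m p∣-m)))
          (periodic-convolve m (λ j → + suc j) (periodic v-mz))
          (λ x → ≡mod-trans (≡⇒≡mod (U-convolve-ramp v-mz x)) (≡mod-+-multiple (∣m⇒∣m*n _ p∣1+a))) r

    U^[p^j*km]≡1 : ∀ j → U^ (p ℕ.^ j ℕ.* (k ℕ.* m)) ≡1[mod + (p ℕ.^ suc j) ]
    U^[p^j*km]≡1 zero = subst₂ U^_≡1[mod_] (sym (ℕP.*-identityˡ (k ℕ.* m)))
                              (cong +_ (sym (ℕP.*-identityʳ p))) U^km≡1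
    U^[p^j*km]≡1 (suc j) = subst₂ U^_≡1[mod_]
      (sym (ℕP.*-assoc p (p ℕ.^ j) (k ℕ.* m)))
      (trans (ℤP.*-comm (+ (p ℕ.^ suc j)) (+ p)) (sym (ℤP.pos-* p (p ℕ.^ suc j))))
      (U^≡1-lift (+ (p ℕ.^ suc j)) {{p^[1+j]≢0}} p∣p^[1+j] (U^[p^j*km]≡1 j))
      where
      p^[1+j]≢0 : ℤ.NonZero (+ (p ℕ.^ suc j))
      p^[1+j]≢0 = ℕP.m^n≢0 p (suc j) {{prime⇒nonZero p-prime}}
      p∣p^[1+j] : + p ∣ + (p ℕ.^ suc j)
      p∣p^[1+j] = divides (+ (p ℕ.^ j)) (trans (ℤP.pos-* p (p ℕ.^ j)) (ℤP.*-comm (+ p) (+ (p ℕ.^ j))))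

    U^T≡1[mod-p^α] : ∀ {α T} → 1 ≤ α →
      (p ℕ.^ (α ℕ.∸ 1) ℕ.* (p ℕ.^ β ℕ.∸ 1)) ℕD.∣ T → U^ T ≡1[mod + (p ℕ.^ α) ]
    U^T≡1[mod-p^α] {suc α} _ (ℕD.divides c T≡c*d) =
      subst (U^_≡1[mod + (p ℕ.^ suc α) ])
            (sym (trans T≡c*d (cong (λ n → c ℕ.* (p ℕ.^ α ℕ.* (n ℕ.∸ 1))) p^β≡1+km)))
            (U^≡1-* (U^[p^j*km]≡1 α) c)

  binomMod≡U^δ : ∀ N r → binomMod m N r a ≡ (U ^ᵒ N) (δ m) r
  binomMod≡U^δ N r = begin
    binomMod m N r a
      ≡⟨ sumTo-cong N term ⟩
    sumTo N (λ k → + (N C k) * (a ^ k * δ m (r - + k)))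
      ≡⟨ sumTo-cong N (λ k → cong (λ t → + (N C k) * (a ^ k * t)) (shift-^ᵒ k (δ m) r)) ⟨
    sumTo N (λ k → + (N C k) * (a ^ k * (shift ^ᵒ k) (δ m) r))
      ≡⟨ I+·^ᵒ-binomial a shift-linear N (δ m) r ⟨
    (U ^ᵒ N) (δ m) r ∎
    where
    open ≡-Reasoning
    if-scale : ∀ (b : Bool) c x → (if b then c * x else 0ℤ) ≡ c * (x * (if b then 1ℤ else 0ℤ))
    if-scale true  c x = cong (c *_) (sym (ℤP.*-identityʳ x))
    if-scale false c x = sym (trans (cong (c *_) (ℤP.*-zeroʳ x)) (ℤP.*-zeroʳ c))
    negate : ∀ k r → - (k - r) ≡ r - k
    negate = solve-∀
    ∣k-r∣≡∣r-k∣ : ∀ k → ℤ.∣ + k - r ∣ ≡ ℤ.∣ r - + k ∣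
    ∣k-r∣≡∣r-k∣ k = trans (sym (ℤP.∣-i∣≡∣i∣ (+ k - r))) (cong ℤ.∣_∣ (negate (+ k) r))
    term : ∀ k → (if ⌊ ≡ᵏ-dec k r m ⌋ then + (N C k) * a ^ k else 0ℤ) ≡ + (N C k) * (a ^ k * δ m (r - + k))
    term k = trans (if-scale ⌊ ≡ᵏ-dec k r m ⌋ (+ (N C k)) (a ^ k))
      (cong (λ n → + (N C k) * (a ^ k * (if ⌊ m ℕD.∣? n ⌋ then 1ℤ else 0ℤ))) (∣k-r∣≡∣r-k∣ k))

  U^N-const : ∀ N c x → (U ^ᵒ N) (λ _ → c) x ≡ (a + 1ℤ) ^ N * c
  U^N-const N c = ^ᵒ-eigen U-linear (a + 1ℤ) (λ _ → factor a c) N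
    where
    factor : ∀ a c → c + a * c ≡ (a + 1ℤ) * c
    factor = solve-∀

  [I-U^T]^n-const : ∀ T n c x → ((I+ - 1ℤ · (U ^ᵒ T)) ^ᵒ n) (λ _ → c) x ≡ (1ℤ - (a + 1ℤ) ^ T) ^ n * c
  [I-U^T]^n-const T n c = ^ᵒ-eigen (I+·-linear (- 1ℤ) (U^-linear T)) (1ℤ - (a + 1ℤ) ^ T)
    (λ x → trans (cong (λ t → c + - 1ℤ * t) (U^N-const T c x)) (factor c ((a + 1ℤ) ^ T))) n
    where
    factor : ∀ c X → c + - 1ℤ * (X * c) ≡ (1ℤ - X) * c
    factor = solve-∀

  module _ (n T l : ℕ) where

    D : Endo
    D = ((I+ - 1ℤ · (U ^ᵒ T)) ^ᵒ n) ∘ (U ^ᵒ l)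

    D-linear : IsLinear D
    D-linear = ∘-linear (^ᵒ-linear (I+·-linear (- 1ℤ) (U^-linear T)) n) (U^-linear l)

    alternating-binomMod-sum≡D : ∀ r →
      sumTo n (λ k → ((- + 1) ^ k) * (+ (n C k)) * binomMod m (k ℕ.* T ℕ.+ l) r a) ≡ D (δ m) r
    alternating-binomMod-sum≡D r = trans (sumTo-cong n term)
      (sym (I+·^ᵒ-binomial (- 1ℤ) (U^-linear T) n ((U ^ᵒ l) (δ m)) r))
      where
      rearrange : ∀ s c x → s * c * x ≡ c * (s * x)
      rearrange = solve-∀
      iterate : ∀ k → binomMod m (k ℕ.* T ℕ.+ l) r a ≡ ((U ^ᵒ T) ^ᵒ k) ((U ^ᵒ l) (δ m)) r
      iterate k = begin
        binomMod m (k ℕ.* T ℕ.+ l) r a          ≡⟨ binomMod≡U^δ (k ℕ.* T ℕ.+ l) r ⟩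
        (U ^ᵒ (k ℕ.* T ℕ.+ l)) (δ m) r          ≡⟨ cong-app (^ᵒ-+ U (k ℕ.* T) l (δ m)) r ⟩
        (U ^ᵒ (k ℕ.* T)) ((U ^ᵒ l) (δ m)) r     ≡⟨ cong (λ f → f ((U ^ᵒ l) (δ m)) r) (^ᵒ-* U k T) ⟨
        ((U ^ᵒ T) ^ᵒ k) ((U ^ᵒ l) (δ m)) r      ∎
        where open ≡-Reasoning
      term : ∀ k → (- + 1) ^ k * + (n C k) * binomMod m (k ℕ.* T ℕ.+ l) r a
                 ≡ + (n C k) * ((- 1ℤ) ^ k * ((U ^ᵒ T) ^ᵒ k) ((U ^ᵒ l) (δ m)) r)
      term k = trans (rearrange ((- + 1) ^ k) (+ (n C k)) _)
                     (cong (λ t → + (n C k) * ((- 1ℤ) ^ k * t)) (iterate k))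

    m*Dδ≡main-term+Dv₀ : ∀ r → + m * D (δ m) r ≡ (a + 1ℤ) ^ l * (1ℤ - (a + 1ℤ) ^ T) ^ n + D (v₀ m) r
    m*Dδ≡main-term+Dv₀ r = begin
      + m * D (δ m) r
        ≡⟨ linear-scale D-linear (+ m) (λ _ → refl) r ⟨
      D (λ x → + m * δ m x) r
        ≡⟨ D-linear 1ℤ 1ℤ (λ x → split (+ m * δ m x)) r ⟩
      1ℤ * D (λ _ → 1ℤ) r + 1ℤ * D (v₀ m) r
        ≡⟨ cong (λ t → 1ℤ * t + 1ℤ * D (v₀ m) r) D1≡ ⟩
      1ℤ * ((1ℤ - (a + 1ℤ) ^ T) ^ n * ((a + 1ℤ) ^ l * 1ℤ)) + 1ℤ * D (v₀ m) r
        ≡⟨ tidy (D (v₀ m) r) ((a + 1ℤ) ^ l) ((1ℤ - (a + 1ℤ) ^ T) ^ n) ⟩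
      (a + 1ℤ) ^ l * (1ℤ - (a + 1ℤ) ^ T) ^ n + D (v₀ m) r ∎
      where
      open ≡-Reasoning
      split : ∀ x → x ≡ 1ℤ * 1ℤ + 1ℤ * (x - 1ℤ)
      split = solve-∀
      tidy : ∀ X L B → 1ℤ * (B * (L * 1ℤ)) + 1ℤ * X ≡ L * B + X
      tidy = solve-∀
      D1≡ : D (λ _ → 1ℤ) r ≡ (1ℤ - (a + 1ℤ) ^ T) ^ n * ((a + 1ℤ) ^ l * 1ℤ)
      D1≡ = trans (linear-cong (^ᵒ-linear (I+·-linear (- 1ℤ) (U^-linear T)) n) (U^N-const l 1ℤ) r)
                  ([I-U^T]^n-const T n ((a + 1ℤ) ^ l * 1ℤ) r)

  U^T≡1[mod-q] : ∀ {q T} .{{_ : ℕ.NonZero m}} .{{_ : ℕ.NonZero q}} → Coprime q m → Coprime q ℤ.∣ S ∣ →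
                 νDivides m q T → U^ T ≡1[mod + q ]
  U^T≡1[mod-q] {q} {T} coprime[q,m] coprime[q,S] ν∣T {v} v-mz r =
    mk≡mod (∣ᵤ⇒∣ (∣-from-exact-prime-powers q _ p^α∣difference))
    where
    p^α∣difference : ∀ {p α} → Prime p → 1 ≤ α → p ℕ.^ α ℕD.∣ q → ¬ (p ℕ.^ suc α ℕD.∣ q) →
                     p ℕ.^ α ℕD.∣ ℤ.∣ (U ^ᵒ T) v r - v r ∣
    p^α∣difference {p} {suc α} p-prime 1≤α p^α∣q p^[1+α]∤q =
      via-order (multiplicative-order (coprime-sym (prime∤⇒coprime p-prime (p∤ coprime[q,m]))))
      where
      instance
        p≢0 : ℕ.NonZero p
        p≢0 = prime⇒nonZero p-prime
      p∣q : p ℕD.∣ q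
      p∣q = ℕD.∣-trans (ℕD.divides (p ℕ.^ α) (ℕP.*-comm p (p ℕ.^ α))) p^α∣q
      p∤ : ∀ {x} → Coprime q x → ¬ (p ℕD.∣ x)
      p∤ coprime[q,x] p∣x = ℕ.nonTrivial⇒≢1 {{prime⇒nonTrivial p-prime}} (coprime[q,x] (p∣q , p∣x))
      p∤m : ¬ (+ p ∣ + m)
      p∤m p∣m = p∤ coprime[q,m] (∣⇒∣ᵤ p∣m)
      p∤S : ¬ (+ p ∣ S)
      p∤S p∣S = p∤ coprime[q,S] (∣⇒∣ᵤ p∣S)
      via-order : Σ ℕ (IsMultOrder m p) → p ℕ.^ suc α ℕD.∣ ℤ.∣ (U ^ᵒ T) v r - v r ∣
      via-order (β , β-order@(_ , p^β≡1[mod-m] , _)) =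
        ∣⇒∣ᵤ (∣-difference (U^T≡1[mod-p^α] p-prime p∤m p∤S {β} {k} p^β≡1+km 1≤α
                             (ν∣T p (suc α) β p-prime 1≤α p^α∣q p^[1+α]∤q β-order) v-mz r))
        where
        m∣p^β∸1 : m ℕD.∣ p ℕ.^ β ℕ.∸ 1
        m∣p^β∸1 = subst (m ℕD.∣_) (∣+n-1∣≡n∸1 (p ℕ.^ β) {{ℕP.m^n≢0 p β}}) p^β≡1[mod-m]
        k = ℕD.quotient m∣p^β∸1
        p^β≡1+km : p ℕ.^ β ≡ suc (k ℕ.* m)
        p^β≡1+km = trans (sym (ℕP.m+[n∸m]≡n (ℕP.m^n>0 p β))) (cong suc (ℕD.m∣n⇒n≡quotient*m m∣p^β∸1))

theorem1p2 : (m : ℕ) → 1 ≤ m → (a : ℤ) → (q : ℕ) → 2 ≤ q →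
    Coprime q m → Coprime q ∣ sumBelow m (λ j → (- a) ℤ.^ j) ∣ →
    (l : ℕ) → (r : ℤ) → (n T : ℕ) → 1 ≤ n → 1 ≤ T → νDivides m q T →
    (mInv : ℤ) → ((+ m) * mInv ≡ + 1 [mod q ℕ.^ n ]) →
    (sumTo n (λ k → ((- + 1) ℤ.^ k) * (+ (n C k)) * binomMod m (k ℕ.* T ℕ.+ l) r a))
      ≡ mInv * ((a ℤ.+ + 1) ℤ.^ l) * ((+ 1 - (a ℤ.+ + 1) ℤ.^ T) ℤ.^ n) [mod q ℕ.^ n ]
theorem1p2 m@(suc M) _ a q@(suc _) _ coprime[q,m] coprime[q,S] l r n T _ _ ν∣T mInv m*mInv≡1 =
  ∣⇒∣ᵤ (∣-difference (subst (λ t → LHS ≡ t ⟨mod + (q ℕ.^ n) ⟩) (sym (ℤP.*-assoc mInv L B))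
                            (≡mod-*-inverse {+ m} {mInv} (mk≡mod (∣ᵤ⇒∣ m*mInv≡1)) m*LHS≡L*B)))
  where
  LHS = sumTo n (λ k → ((- + 1) ^ k) * (+ (n C k)) * binomMod m (k ℕ.* T ℕ.+ l) r a)
  L = (a + 1ℤ) ^ l
  B = (1ℤ - (a + 1ℤ) ^ T) ^ n
  q^n∣Dv₀ : + (q ℕ.^ n) ∣ D m a n T l (v₀ m) r
  q^n∣Dv₀ = q^n∣[I-U^T]^n m a {T} q (U^T≡1[mod-q] m a {q} {T} coprime[q,m] coprime[q,S] ν∣T) n
                          (meanZero-U^ m a l (meanZero-v₀ M)) r
  m*LHS≡L*B : + m * LHS ≡ L * B ⟨mod + (q ℕ.^ n) ⟩
  m*LHS≡L*B = subst (λ t → t ≡ L * B ⟨mod + (q ℕ.^ n) ⟩)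
    (sym (trans (cong (+ m *_) (alternating-binomMod-sum≡D m a n T l r)) (m*Dδ≡main-term+Dv₀ m a n T l r)))
    (≡mod-+-multiple q^n∣Dv₀)
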